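{- Let $K = K_{n_1}\,\square\,K_{n_2}\,\square\,\cdots\,\square\,K_{n_m}$ with $m\ge 2$ and each $n_i\ge 2$. Then $K$ is $1/2$-RA or RA, and it is RA if and only if $m$ is even or at least one $n_i$ is odd.
   Context: $K_n$ is the complete graph on $n$ vertices. The cartesian product $\Gamma_1\,\square\,\Gamma_2$ has vertex set $V(\Gamma_1)\times V(\Gamma_2)$, with $(u_1,u_2)$ adjacent to $(v_1,v_2)$ iff they agree in one coordinate and are adjacent in the other. For a vertex $v$, $N[v]$ is the closed neighbourhood; for a vertex set $S$, $\vec S$ is its $0/1$ indicator vector. The RA matrix $C_\Gamma$ of a graph $\Gamma$ on $N$ vertices has $N$ columns and rows $\vec{N[v]}$ for all vertices $v$ together with $\overrightarrow{N[u]\cap N[v]}$ for all pairs $u,v$. For $k\ge1$, $\Gamma$ is $1/k$-RA if for every ordering of the columns of $C_\Gamma$, the diagonal of the Hermite normal form of $C_\Gamma$ is $(1,\dots,1,k)$ ($N-1$ ones). For a group $G$, $G^\Gamma\le G^N$ is generated by the elements $g^v$ having $g$ at coordinates of $N[v]$ and identity elsewhere; $\Gamma$ is RA if $[G,G]^N\le G^\Gamma$ for all groups $G$. It is known that $\Gamma$ is RA iff the row span of $C_\Gamma$ over $\mathbb{Z}$ is $\mathbb{Z}^N$, i.e. iff $\Gamma$ is $1/1$-RA. -}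

module Defs where

open import Level using (0ℓ)
open import Data.Bool using (Bool; true; false; if_then_else_; _∨_; _∧_; not)
open import Data.Nat as ℕ using (ℕ; zero; suc)
open import Data.Fin as Fin using (Fin; toℕ; remQuot; _≟_)
open import Data.Integer as ℤ using (ℤ; +_)
open import Data.List using (List; []; _∷_; map; tabulate; _++_; concatMap)
open import Data.List.Membership.Propositional using (_∈_)
open import Data.Product using (Σ; ∃; ∃-syntax; _×_; _,_)
open import Relation.Binary.PropositionalEquality using (_≡_)
open import Relation.Nullary.Decidable using (⌊_⌋)
open import Function.Bundles using (_↔_; Inverse)
open import Algebra.Bundles using (Group)

record Graph : Set where
  field
    N   : ℕ
    adj : Fin N → Fin N → Bool
open Graph public

K : ℕ → Graph
K n = record { N = n ; adj = λ u v → not ⌊ u ≟ v ⌋ }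

_□_ : Graph → Graph → Graph
Γ₁ □ Γ₂ = record { N = N Γ₁ ℕ.* N Γ₂ ; adj = a }
  where
  a : Fin (N Γ₁ ℕ.* N Γ₂) → Fin (N Γ₁ ℕ.* N Γ₂) → Bool
  a x y with remQuot {N Γ₁} (N Γ₂) x | remQuot {N Γ₁} (N Γ₂) y
  ... | (x₁ , x₂) | (y₁ , y₂) =
    (⌊ x₁ ≟ y₁ ⌋ ∧ adj Γ₂ x₂ y₂) ∨ (⌊ x₂ ≟ y₂ ⌋ ∧ adj Γ₁ x₁ y₁)

-- K_{n 0} □ K_{n 1} □ ⋯ □ K_{n (m-1)}  (the case m = 0 is never used)
KProd : (m : ℕ) → (Fin m → ℕ) → Graph
KProd zero          n = K 1
KProd (suc zero)    n = K (n Fin.zero)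
KProd (suc (suc m)) n = K (n Fin.zero) □ KProd (suc m) (λ i → n (Fin.suc i))

inN : (Γ : Graph) → Fin (N Γ) → Fin (N Γ) → Bool
inN Γ v w = ⌊ v ≟ w ⌋ ∨ adj Γ v w

indicator : Bool → ℤ
indicator true  = + 1
indicator false = + 0

RArows : (Γ : Graph) → List (Fin (N Γ) → ℤ)
RArows Γ =
  tabulate (λ v w → indicator (inN Γ v w)) ++
  concatMap (λ u → tabulate (λ v w → indicator (inN Γ u w ∧ inN Γ v w)))
            (tabulate (λ i → i))

lincomb : ∀ {N} → List (Fin N → ℤ) → List ℤ → Fin N → ℤ
lincomb (r ∷ rs) (c ∷ cs) j = c ℤ.* r j ℤ.+ lincomb rs cs j
lincomb _        _        j = + 0

InSpan : ∀ {N} → List (Fin N → ℤ) → (Fin N → ℤ) → Set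
InSpan rows x = ∃[ cs ] (∀ j → x j ≡ lincomb rows cs j)

SameSpan : ∀ {N} → List (Fin N → ℤ) → (Fin N → Fin N → ℤ) → Set
SameSpan {N} rows H =
  (∀ r → r ∈ rows → InSpan (tabulate H) r) × (∀ i → InSpan rows (H i))

IsHNF : ∀ {N} → (Fin N → Fin N → ℤ) → Set
IsHNF H =
  (∀ i j → toℕ j ℕ.< toℕ i → H i j ≡ + 0) ×
  (∀ i → + 0 ℤ.< H i i) ×
  (∀ i j → toℕ i ℕ.< toℕ j → (+ 0 ℤ.≤ H i j) × (H i j ℤ.< H j j))

permRows : (Γ : Graph) → (Fin (N Γ) ↔ Fin (N Γ)) → List (Fin (N Γ) → ℤ)
permRows Γ σ = map (λ r j → r (Inverse.to σ j)) (RArows Γ)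

OneOverRA : Graph → ℕ → Set
OneOverRA Γ k =
  (1 ℕ.≤ k) ×
  (∀ (σ : Fin (N Γ) ↔ Fin (N Γ)) →
     ∃[ H ] (IsHNF H × SameSpan (permRows Γ σ) H ×
             (∀ i → (suc (toℕ i) ℕ.< N Γ → H i i ≡ + 1) ×
                    (suc (toℕ i) ≡ N Γ → H i i ≡ + k))))

module _ (G : Group 0ℓ 0ℓ) where
  open Group G renaming (Carrier to A)

  data InComm : A → Set where
    comm  : ∀ a b → InComm (a ⁻¹ ∙ b ⁻¹ ∙ a ∙ b)
    unit  : InComm ε
    mul   : ∀ {x y} → InComm x → InComm y → InComm (x ∙ y)
    inv   : ∀ {x} → InComm x → InComm (x ⁻¹)
    resp  : ∀ {x y} → x ≈ y → InComm x → InComm y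

  data InGΓ (Γ : Graph) : (Fin (N Γ) → A) → Set where
    gen   : ∀ (g : A) v → InGΓ Γ (λ w → if inN Γ v w then g else ε)
    unit  : InGΓ Γ (λ _ → ε)
    mul   : ∀ {x y} → InGΓ Γ x → InGΓ Γ y → InGΓ Γ (λ w → x w ∙ y w)
    inv   : ∀ {x} → InGΓ Γ x → InGΓ Γ (λ w → x w ⁻¹)
    resp  : ∀ {x y} → (∀ w → x w ≈ y w) → InGΓ Γ x → InGΓ Γ y

RA : Graph → Set₁
RA Γ = ∀ (G : Group 0ℓ 0ℓ) (x : Fin (N Γ) → Group.Carrier G) →
       (∀ w → InComm G (x w)) → InGΓ G Γ x

-- Let L ⊆ ℤᴺ be the row lattice of C_Γ for Γ = K_{n₁} □ ⋯ □ K_{n_m}.  Common-neighbourhood rows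
-- of vertices in different fibres give e_u ± e_w ∈ L for all vertices u, w, and a 4-cycle gives
-- 2e_u ∈ L, so L contains the checkerboard lattice Dₙ of vectors with even coordinate sum.  Over F₂
-- the neighbourhoods of K_a □ Γ′ are sums of tensors, which yields
--   |N[(p,x)] ∩ N[(q,v)]| ≡ a·[x = v] + [p = q]·(|N[x] ∩ N[v]| + [x = v])  (mod 2).
-- If some nᵢ is odd or m is even, some row has odd support, so L = ℤᴺ; then every eᵥ ∈ L and
-- raising commutators [a, b] to the entries of L shows [G, G]ᴺ ≤ G^Γ.  Otherwise every row has
-- even support and L = Dₙ, whose Hermite normal form is (1, …, 1, 2) in every column order; and in
-- the Heisenberg group over F₂ the parity of the central coordinates is invariant on G^Γ but not
-- on [G, G]ᴺ, so Γ is not RA.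

module Submission where

open import Defs
open import Level using (0ℓ)
open import Algebra.Bundles using (Group)
open import Data.Bool as Bool using (Bool; true; false; _∧_; _∨_; _xor_; not; if_then_else_)
open import Data.Bool.Properties
  using (not-involutive; not-¬; ¬-not; ∧-comm; ∧-idem; ∧-zeroʳ; ∧-identityʳ; ∧-conicalˡ; ∨-zeroʳ; ∨-identityʳ;
         ∧-distribˡ-∨; xor-identityʳ; xor-assoc; xor-same; ∧-distribˡ-xor; ∧-distribʳ-xor)
open import Data.Bool.Solver using (module xor-∧-Solver)
open import Data.Empty using (⊥-elim)
open import Data.Fin as Fin using (Fin; toℕ; combine; remQuot; _≟_; _↑ˡ_; _↑ʳ_)
open import Data.Fin.Properties
  using (any?; remQuot-combine; combine-remQuot; combine-injective; toℕ-injective; toℕ<n; toℕ-fromℕ)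
open import Data.Integer as ℤ using (ℤ; +_; -[1+_]; _+_; _-_; -_; _*_)
import Data.Integer.Properties as ℤ
open import Data.Integer.Tactic.RingSolver using (solve-∀)
open import Data.List using (List; []; _∷_; map; tabulate)
open import Data.List.Membership.Propositional using (_∈_)
open import Data.List.Membership.Propositional.Properties
  using (∈-++⁺ˡ; ∈-++⁺ʳ; ∈-++⁻; ∈-tabulate⁺; ∈-tabulate⁻; ∈-concatMap⁺; ∈-concatMap⁻; ∈-map⁺; ∈-map⁻)
open import Data.List.Relation.Unary.Any as Any using (here; there)
open import Data.Nat as ℕ using (ℕ; zero; suc; s≤s; z≤n; _≤_)
import Data.Nat.Properties as ℕ
open import Data.Nat.Divisibility using (_∣_; divides)
open import Data.Product using (Σ; ∃; ∃-syntax; _×_; _,_; proj₁; proj₂)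
open import Data.Sum using (_⊎_; inj₁; inj₂)
open import Function using (_∘_)
open import Function.Bundles using (_↔_; Inverse; _⇔_; mk⇔)
open import Relation.Binary.PropositionalEquality
  using (_≡_; _≢_; refl; sym; trans; cong; cong₂; subst; isEquivalence; module ≡-Reasoning)
open import Relation.Nullary using (¬_; yes; no; ¬?)
open import Relation.Nullary.Decidable using (⌊_⌋; _×-dec_)

δ : ∀ {n} → Fin n → Fin n → Bool
δ x y = ⌊ x ≟ y ⌋

δ-refl : ∀ {n} (x : Fin n) → δ x x ≡ true
δ-refl x with x ≟ x
... | yes _ = refl
... | no x≢x = ⊥-elim (x≢x refl)

δ-≢ : ∀ {n} {x y : Fin n} → x ≢ y → δ x y ≡ false
δ-≢ {x = x} {y} x≢y with x ≟ y
... | yes x≡y = ⊥-elim (x≢y x≡y)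
... | no _ = refl

δ≡true⇒≡ : ∀ {n} {x y : Fin n} → δ x y ≡ true → x ≡ y
δ≡true⇒≡ {x = x} {y} δ≡true with x ≟ y
... | yes x≡y = x≡y
... | no _ with () ← δ≡true

δ-sym : ∀ {n} (x y : Fin n) → δ x y ≡ δ y x
δ-sym x y with x ≟ y
... | yes refl = sym (δ-refl x)
... | no x≢y = sym (δ-≢ (x≢y ∘ sym))

δ-suc : ∀ {n} (x y : Fin n) → δ (Fin.suc x) (Fin.suc y) ≡ δ x y
δ-suc x y with x ≟ y
... | yes refl = refl
... | no _ = refl

δ-disjoint : ∀ {n} {x y : Fin n} → x ≢ y → ∀ z → δ x z ∧ δ y z ≡ false
δ-disjoint {x = x} x≢y z with x ≟ z
... | yes refl = δ-≢ (x≢y ∘ sym)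
... | no _ = refl

odd : ℕ → Bool
odd zero = false
odd (suc n) = not (odd n)

parity : ∀ {n} → (Fin n → Bool) → Bool
parity {zero} f = false
parity {suc n} f = f Fin.zero xor parity (f ∘ Fin.suc)

parity-cong : ∀ {n} {f g : Fin n → Bool} → (∀ j → f j ≡ g j) → parity f ≡ parity g
parity-cong {zero} f≗g = refl
parity-cong {suc n} f≗g = cong₂ _xor_ (f≗g Fin.zero) (parity-cong (f≗g ∘ Fin.suc))

parity-false : ∀ {n} → parity {n} (λ _ → false) ≡ false
parity-false {zero} = refl
parity-false {suc n} = parity-false {n}

parity-true : ∀ {n} → parity {n} (λ _ → true) ≡ odd n
parity-true {zero} = refl
parity-true {suc n} = cong not (parity-true {n})

parity-∧ˡ : ∀ {n} c (f : Fin n → Bool) → parity (λ j → c ∧ f j) ≡ c ∧ parity f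
parity-∧ˡ true f = refl
parity-∧ˡ {n} false f = parity-false {n}

parity-xor : ∀ {n} (f g : Fin n → Bool) → parity (λ j → f j xor g j) ≡ parity f xor parity g
parity-xor {zero} f g = refl
parity-xor {suc n} f g =
  trans (cong ((f Fin.zero xor g Fin.zero) xor_) (parity-xor (f ∘ Fin.suc) (g ∘ Fin.suc)))
        (xor-interchange (f Fin.zero) (g Fin.zero) _ _)
  where
  open xor-∧-Solver
  xor-interchange : ∀ a b c d → (a xor b) xor (c xor d) ≡ (a xor c) xor (b xor d)
  xor-interchange = solve 4 (λ a b c d → (a :+ b) :+ (c :+ d) := (a :+ c) :+ (b :+ d)) refl

parity-δ : ∀ {n} (x : Fin n) (f : Fin n → Bool) → parity (λ y → δ x y ∧ f y) ≡ f x
parity-δ {suc n} Fin.zero f = trans (cong (f Fin.zero xor_) (parity-false {n})) (xor-identityʳ _)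
parity-δ {suc n} (Fin.suc x) f =
  trans (parity-cong (λ y → cong (_∧ f (Fin.suc y)) (δ-suc x y))) (parity-δ x (f ∘ Fin.suc))

parity-++ : ∀ {m n} (f : Fin (m ℕ.+ n) → Bool) →
            parity f ≡ parity (λ i → f (i ↑ˡ n)) xor parity (λ j → f (m ↑ʳ j))
parity-++ {zero} f = refl
parity-++ {suc m} {n} f =
  trans (cong (f Fin.zero xor_) (parity-++ {m} (f ∘ Fin.suc))) (sym (xor-assoc (f Fin.zero) _ _))

parity-combine : ∀ {m n} (f : Fin (m ℕ.* n) → Bool) →
                 parity f ≡ parity {m} (λ i → parity {n} (λ j → f (combine i j)))
parity-combine {zero} f = refl
parity-combine {suc m} {n} f =
  trans (parity-++ {n} f)
        (cong (parity (λ j → f (j ↑ˡ m ℕ.* n)) xor_) (parity-combine {m} (λ k → f (n ↑ʳ k))))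

parity-∧ʳ : ∀ {n} (f : Fin n → Bool) c → parity (λ j → f j ∧ c) ≡ parity f ∧ c
parity-∧ʳ f c = trans (parity-cong (λ j → ∧-comm (f j) c))
                      (trans (parity-∧ˡ c f) (∧-comm c (parity f)))

infixr 5 _⊕_
infixr 6 _⊗_
infix 7 _·_

_⊕_ : ∀ {n} → (Fin n → Bool) → (Fin n → Bool) → Fin n → Bool
(f ⊕ g) j = f j xor g j

_·_ : ∀ {n} → (Fin n → Bool) → (Fin n → Bool) → Bool
f · g = parity (λ j → f j ∧ g j)

_⊗_ : ∀ {m n} → (Fin m → Bool) → (Fin n → Bool) → Fin (m ℕ.* n) → Bool
_⊗_ {m} {n} f g w = f (proj₁ (remQuot {m} n w)) ∧ g (proj₂ (remQuot {m} n w))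

·-cong : ∀ {n} {f f′ g g′ : Fin n → Bool} →
         (∀ j → f j ≡ f′ j) → (∀ j → g j ≡ g′ j) → f · g ≡ f′ · g′
·-cong f≗f′ g≗g′ = parity-cong (λ j → cong₂ _∧_ (f≗f′ j) (g≗g′ j))

·-comm : ∀ {n} (f g : Fin n → Bool) → f · g ≡ g · f
·-comm f g = parity-cong (λ j → ∧-comm (f j) (g j))

·-⊕ˡ : ∀ {n} (f g h : Fin n → Bool) → (f ⊕ g) · h ≡ (f · h) xor (g · h)
·-⊕ˡ f g h = trans (parity-cong (λ j → ∧-distribʳ-xor (h j) (f j) (g j)))
                   (parity-xor (λ j → f j ∧ h j) (λ j → g j ∧ h j))

·-⊕ʳ : ∀ {n} (f g h : Fin n → Bool) → f · (g ⊕ h) ≡ (f · g) xor (f · h)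
·-⊕ʳ f g h = trans (parity-cong (λ j → ∧-distribˡ-xor (f j) (g j) (h j)))
                   (parity-xor (λ j → f j ∧ g j) (λ j → f j ∧ h j))

δ-· : ∀ {n} (x : Fin n) (f : Fin n → Bool) → δ x · f ≡ f x
δ-· = parity-δ

·-δ : ∀ {n} (f : Fin n → Bool) (x : Fin n) → f · δ x ≡ f x
·-δ f x = trans (·-comm f (δ x)) (δ-· x f)

⊗-combine : ∀ {m n} (f : Fin m → Bool) (g : Fin n → Bool) i j → (f ⊗ g) (combine i j) ≡ f i ∧ g j
⊗-combine {m} {n} f g i j = cong (λ ij → f (proj₁ ij) ∧ g (proj₂ ij)) (remQuot-combine {m} {n} i j)

·-⊗ : ∀ {m n} (f f′ : Fin m → Bool) (g g′ : Fin n → Bool) →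
      (f ⊗ g) · (f′ ⊗ g′) ≡ (f · f′) ∧ (g · g′)
·-⊗ {m} {n} f f′ g g′ = begin
  (f ⊗ g) · (f′ ⊗ g′)
    ≡⟨ parity-combine {m} {n} _ ⟩
  parity {m} (λ i → parity {n} (λ j → (f ⊗ g) (combine i j) ∧ (f′ ⊗ g′) (combine i j)))
    ≡⟨ parity-cong (λ i → parity-cong (λ j →
         cong₂ _∧_ (⊗-combine f g i j) (⊗-combine f′ g′ i j))) ⟩
  parity {m} (λ i → parity {n} (λ j → (f i ∧ g j) ∧ (f′ i ∧ g′ j)))
    ≡⟨ parity-cong (λ i → parity-cong (λ j → interchange (f i) (g j) (f′ i) (g′ j))) ⟩
  parity {m} (λ i → parity {n} (λ j → (f i ∧ f′ i) ∧ (g j ∧ g′ j)))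
    ≡⟨ parity-cong (λ i → parity-∧ˡ (f i ∧ f′ i) (λ j → g j ∧ g′ j)) ⟩
  parity (λ i → (f i ∧ f′ i) ∧ (g · g′))
    ≡⟨ parity-∧ʳ (λ i → f i ∧ f′ i) (g · g′) ⟩
  (f · f′) ∧ (g · g′) ∎
  where
  open ≡-Reasoning
  open xor-∧-Solver
  interchange : ∀ a b c d → (a ∧ b) ∧ (c ∧ d) ≡ (a ∧ c) ∧ (b ∧ d)
  interchange = solve 4 (λ a b c d → (a :* b) :* (c :* d) := (a :* c) :* (b :* d)) refl

-- * Subgroups of ℤⁿ and the checkerboard lattice

e : ∀ {n} → Fin n → Fin n → ℤ
e x y = indicator (δ x y)

e-suc : ∀ {n} (x y : Fin n) → e (Fin.suc x) (Fin.suc y) ≡ e x y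
e-suc x y = cong indicator (δ-suc x y)

record IsSubgroup {n} (M : (Fin n → ℤ) → Set) : Set where
  field
    0∈       : M (λ _ → + 0)
    +∈       : ∀ {f g} → M f → M g → M (λ j → f j + g j)
    -∈       : ∀ {f} → M f → M (λ j → - f j)
    ∈-resp-≗ : ∀ {f g} → (∀ j → f j ≡ g j) → M f → M g

  −∈ : ∀ {f g} → M f → M g → M (λ j → f j - g j)
  −∈ f∈ g∈ = +∈ f∈ (-∈ g∈)

data Span {n} (R : (Fin n → ℤ) → Set) : (Fin n → ℤ) → Set where
  gen  : ∀ {f} → R f → Span R f
  nil  : Span R (λ _ → + 0)
  add  : ∀ {f g} → Span R f → Span R g → Span R (λ j → f j + g j)
  neg  : ∀ {f} → Span R f → Span R (λ j → - f j)
  resp : ∀ {f g} → (∀ j → f j ≡ g j) → Span R f → Span R g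

Span-isSubgroup : ∀ {n} (R : (Fin n → ℤ) → Set) → IsSubgroup (Span R)
Span-isSubgroup R = record { 0∈ = nil ; +∈ = add ; -∈ = neg ; ∈-resp-≗ = resp }

zipWith-+ : List ℤ → List ℤ → List ℤ
zipWith-+ [] ds = ds
zipWith-+ (c ∷ cs) [] = c ∷ cs
zipWith-+ (c ∷ cs) (d ∷ ds) = c + d ∷ zipWith-+ cs ds

lincomb-[] : ∀ {n} (rows : List (Fin n → ℤ)) j → lincomb rows [] j ≡ + 0
lincomb-[] [] j = refl
lincomb-[] (r ∷ rows) j = refl

lincomb-+ : ∀ {n} (rows : List (Fin n → ℤ)) cs ds j →
            lincomb rows (zipWith-+ cs ds) j ≡ lincomb rows cs j + lincomb rows ds j
lincomb-+ [] cs ds j = refl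
lincomb-+ (r ∷ rows) [] ds j = sym (ℤ.+-identityˡ _)
lincomb-+ (r ∷ rows) (c ∷ cs) [] j = sym (ℤ.+-identityʳ _)
lincomb-+ (r ∷ rows) (c ∷ cs) (d ∷ ds) j
  rewrite lincomb-+ rows cs ds j = distrib c d (r j) (lincomb rows cs j) (lincomb rows ds j)
  where
  distrib : ∀ c d r x y → (c + d) * r + (x + y) ≡ (c * r + x) + (d * r + y)
  distrib = solve-∀

lincomb-neg : ∀ {n} (rows : List (Fin n → ℤ)) cs j → lincomb rows (map -_ cs) j ≡ - lincomb rows cs j
lincomb-neg [] cs j = refl
lincomb-neg (r ∷ rows) [] j = refl
lincomb-neg (r ∷ rows) (c ∷ cs) j
  rewrite lincomb-neg rows cs j = distrib c (r j) (lincomb rows cs j)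
  where
  distrib : ∀ c r x → - c * r + - x ≡ - (c * r + x)
  distrib = solve-∀

∈⇒InSpan : ∀ {n} {rows : List (Fin n → ℤ)} {f} → f ∈ rows → InSpan rows f
∈⇒InSpan {rows = r ∷ rows} (here refl) =
  + 1 ∷ [] , λ j → trans (sym (ℤ.+-identityʳ (r j)))
                         (cong₂ _+_ (sym (ℤ.*-identityˡ (r j))) (sym (lincomb-[] rows j)))
∈⇒InSpan {rows = r ∷ rows} (there f∈) =
  let cs , f≗ = ∈⇒InSpan f∈ in + 0 ∷ cs , λ j → trans (f≗ j) (sym (ℤ.+-identityˡ _))

Span⇒InSpan : ∀ {n} {rows : List (Fin n → ℤ)} {f} → Span (_∈ rows) f → InSpan rows f
Span⇒InSpan (gen f∈) = ∈⇒InSpan f∈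
Span⇒InSpan {rows = rows} nil = [] , λ j → sym (lincomb-[] rows j)
Span⇒InSpan {rows = rows} (add f∈ g∈) =
  let cs , f≗ = Span⇒InSpan f∈ ; ds , g≗ = Span⇒InSpan g∈
  in zipWith-+ cs ds , λ j → trans (cong₂ _+_ (f≗ j) (g≗ j)) (sym (lincomb-+ rows cs ds j))
Span⇒InSpan {rows = rows} (neg f∈) =
  let cs , f≗ = Span⇒InSpan f∈ in map -_ cs , λ j → trans (cong -_ (f≗ j)) (sym (lincomb-neg rows cs j))
Span⇒InSpan (resp f≗g f∈) =
  let cs , f≗ = Span⇒InSpan f∈ in cs , λ j → trans (sym (f≗g j)) (f≗ j)

-- The checkerboard lattice Dₙ = {v ∈ ℤⁿ | Σ v even} is generated by these vectors.
record ContainsCheckerboard {n} (M : (Fin n → ℤ) → Set) : Set where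
  field
    e-e∈ : ∀ x y → M (λ j → e x j - e y j)
    2e∈  : ∀ x → M (λ j → e x j + e x j)

cons0 : ∀ {n} → (Fin n → ℤ) → Fin (suc n) → ℤ
cons0 f Fin.zero = + 0
cons0 f (Fin.suc j) = f j

module _ {n} {M : (Fin (suc n) → ℤ) → Set} (M-sub : IsSubgroup M) where
  open IsSubgroup M-sub

  cons0-isSubgroup : IsSubgroup (M ∘ cons0)
  cons0-isSubgroup = record
    { 0∈ = ∈-resp-≗ (λ { Fin.zero → refl ; (Fin.suc j) → refl }) 0∈
    ; +∈ = λ f∈ g∈ → ∈-resp-≗ (λ { Fin.zero → refl ; (Fin.suc j) → refl }) (+∈ f∈ g∈)
    ; -∈ = λ f∈ → ∈-resp-≗ (λ { Fin.zero → refl ; (Fin.suc j) → refl }) (-∈ f∈)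
    ; ∈-resp-≗ = λ f≗g → ∈-resp-≗ (λ { Fin.zero → refl ; (Fin.suc j) → f≗g j })
    }

  cons0-containsCheckerboard : ContainsCheckerboard M → ContainsCheckerboard (M ∘ cons0)
  cons0-containsCheckerboard D = record
    { e-e∈ = λ x y →
        ∈-resp-≗ (λ { Fin.zero → refl ; (Fin.suc j) → cong₂ _-_ (e-suc x j) (e-suc y j) })
                 (e-e∈ (Fin.suc x) (Fin.suc y))
    ; 2e∈ = λ x → ∈-resp-≗ (λ { Fin.zero → refl ; (Fin.suc j) → cong₂ _+_ (e-suc x j) (e-suc x j) })
                           (2e∈ (Fin.suc x))
    }
    where open ContainsCheckerboard D

indicator≡parity-mod-checkerboard :
  ∀ {n} {M : (Fin (suc n) → ℤ) → Set} → IsSubgroup M → ContainsCheckerboard M →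
  ∀ b → M (λ j → indicator (b j) - indicator (parity b) * e Fin.zero j)
indicator≡parity-mod-checkerboard {zero} M-sub D b =
  IsSubgroup.∈-resp-≗ M-sub (λ { Fin.zero → vanishes (b Fin.zero) }) (IsSubgroup.0∈ M-sub)
  where
  vanishes : ∀ c → + 0 ≡ indicator c - indicator (c xor false) * + 1
  vanishes true = refl
  vanishes false = refl
indicator≡parity-mod-checkerboard {suc n} {M} M-sub D b =
  ∈-resp-≗ tail+head≗ (+∈ tail∈ (head-correction (b Fin.zero) (parity (b ∘ Fin.suc))))
  where
  open IsSubgroup M-sub
  open ContainsCheckerboard D
  e₀ e₁ : Fin (suc (suc n)) → ℤ
  e₀ = e Fin.zero
  e₁ = e (Fin.suc Fin.zero)

  tail∈ : M (cons0 (λ j → indicator (b (Fin.suc j)) - indicator (parity (b ∘ Fin.suc)) * e Fin.zero j))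
  tail∈ = indicator≡parity-mod-checkerboard (cons0-isSubgroup M-sub) (cons0-containsCheckerboard M-sub D)
                                            (b ∘ Fin.suc)

  head-correction : ∀ b₀ p → M (λ j → indicator p * e₁ j + (indicator b₀ - indicator (b₀ xor p)) * e₀ j)
  head-correction b₀ false rewrite xor-identityʳ b₀ =
    ∈-resp-≗ (λ j → sym (zero-coeffs (indicator b₀) (e₁ j) (e₀ j))) 0∈
    where
    zero-coeffs : ∀ c x y → + 0 * x + (c - c) * y ≡ + 0
    zero-coeffs = solve-∀
  head-correction true true = ∈-resp-≗ (λ j → sums (e₁ j) (e₀ j)) (+∈ (e-e∈ (Fin.suc Fin.zero) Fin.zero) (2e∈ Fin.zero))
    where
    sums : ∀ x y → (x - y) + (y + y) ≡ + 1 * x + (+ 1 - + 0) * y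
    sums = solve-∀
  head-correction false true = ∈-resp-≗ (λ j → diff (e₁ j) (e₀ j)) (e-e∈ (Fin.suc Fin.zero) Fin.zero)
    where
    diff : ∀ x y → x - y ≡ + 1 * x + (+ 0 - + 1) * y
    diff = solve-∀

  tail+head≗ : ∀ j → cons0 (λ j → indicator (b (Fin.suc j)) - indicator (parity (b ∘ Fin.suc)) * e Fin.zero j) j
                     + (indicator (parity (b ∘ Fin.suc)) * e₁ j + (indicator (b Fin.zero) - indicator (parity b)) * e₀ j)
                   ≡ indicator (b j) - indicator (parity b) * e₀ j
  tail+head≗ Fin.zero = at-head (indicator (parity (b ∘ Fin.suc))) (indicator (b Fin.zero)) (indicator (parity b))
    where
    at-head : ∀ p b₀ q → + 0 + (p * + 0 + (b₀ - q) * + 1) ≡ b₀ - q * + 1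
    at-head = solve-∀
  tail+head≗ (Fin.suc j) rewrite e-suc Fin.zero j =
    off-head (indicator (b (Fin.suc j))) (indicator (parity (b ∘ Fin.suc))) (e Fin.zero j)
             (indicator (b Fin.zero) - indicator (parity b)) (indicator (parity b))
    where
    off-head : ∀ x p y c q → (x - p * y) + (p * y + c * + 0) ≡ x - q * + 0
    off-head = solve-∀

even-indicator∈ : ∀ {n} {M : (Fin n → ℤ) → Set} → IsSubgroup M → ContainsCheckerboard M →
                  ∀ b → parity b ≡ false → M (λ j → indicator (b j))
even-indicator∈ {zero} M-sub D b _ = IsSubgroup.∈-resp-≗ M-sub (λ ()) (IsSubgroup.0∈ M-sub)
even-indicator∈ {suc n} M-sub D b even =
  IsSubgroup.∈-resp-≗ M-sub drop-parity (indicator≡parity-mod-checkerboard M-sub D b)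
  where
  drop-parity : ∀ j → indicator (b j) - indicator (parity b) * e Fin.zero j ≡ indicator (b j)
  drop-parity j rewrite even = lemma (indicator (b j)) (e Fin.zero j)
    where
    lemma : ∀ x y → x - + 0 * y ≡ x
    lemma = solve-∀

odd-indicator∈⇒e∈ : ∀ {n} {M : (Fin n → ℤ) → Set} → IsSubgroup M → ContainsCheckerboard M →
                    ∀ b → parity b ≡ true → M (λ j → indicator (b j)) → ∀ x → M (e x)
odd-indicator∈⇒e∈ {suc n} M-sub D b odd b∈ x =
  ∈-resp-≗ is-e (+∈ (−∈ b∈ (indicator≡parity-mod-checkerboard M-sub D b)) (e-e∈ x Fin.zero))
  where
  open IsSubgroup M-sub
  open ContainsCheckerboard D
  is-e : ∀ j → (indicator (b j) - (indicator (b j) - indicator (parity b) * e Fin.zero j))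
               + (e x j - e Fin.zero j) ≡ e x j
  is-e j rewrite odd = lemma (indicator (b j)) (e Fin.zero j) (e x j)
    where
    lemma : ∀ c y z → (c - (c - + 1 * y)) + (z - y) ≡ z
    lemma = solve-∀

Linked : ∀ {n} → ((Fin n → ℤ) → Set) → Fin n → Fin n → Set
Linked M u w = M (λ j → e u j - e w j) ⊎ M (λ j → e u j + e w j)

module _ {n} {M : (Fin n → ℤ) → Set} (M-sub : IsSubgroup M) where
  open IsSubgroup M-sub

  linked-refl : ∀ u → Linked M u u
  linked-refl u = inj₁ (∈-resp-≗ (λ j → sym (ℤ.+-inverseʳ (e u j))) 0∈)

  linked-trans : ∀ {u v w} → Linked M u v → Linked M v w → Linked M u w
  linked-trans {u} {v} {w} (inj₁ u-v) (inj₁ v-w) = inj₁ (∈-resp-≗ (λ j → telescope (e u j) (e v j) (e w j)) (+∈ u-v v-w))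
    where telescope : ∀ x y z → (x - y) + (y - z) ≡ x - z
          telescope = solve-∀
  linked-trans {u} {v} {w} (inj₁ u-v) (inj₂ v+w) = inj₂ (∈-resp-≗ (λ j → telescope (e u j) (e v j) (e w j)) (+∈ u-v v+w))
    where telescope : ∀ x y z → (x - y) + (y + z) ≡ x + z
          telescope = solve-∀
  linked-trans {u} {v} {w} (inj₂ u+v) (inj₁ v-w) = inj₂ (∈-resp-≗ (λ j → telescope (e u j) (e v j) (e w j)) (−∈ u+v v-w))
    where telescope : ∀ x y z → (x + y) - (y - z) ≡ x + z
          telescope = solve-∀
  linked-trans {u} {v} {w} (inj₂ u+v) (inj₂ v+w) = inj₁ (∈-resp-≗ (λ j → telescope (e u j) (e v j) (e w j)) (−∈ u+v v+w))
    where telescope : ∀ x y z → (x + y) - (y + z) ≡ x - z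
          telescope = solve-∀

  linked⇒checkerboard : (∀ u w → Linked M u w) → ∀ {u₀} → M (λ j → e u₀ j + e u₀ j) →
                        ContainsCheckerboard M
  linked⇒checkerboard linked {u₀} 2e₀∈ = record { e-e∈ = e-e∈ ; 2e∈ = 2e∈ }
    where
    e-e₀∈ : ∀ u → M (λ j → e u j - e u₀ j)
    e-e₀∈ u with linked u u₀
    ... | inj₁ u-u₀ = u-u₀
    ... | inj₂ u+u₀ = ∈-resp-≗ (λ j → lemma (e u j) (e u₀ j)) (−∈ u+u₀ 2e₀∈)
      where lemma : ∀ x y → (x + y) - (y + y) ≡ x - y
            lemma = solve-∀
    e-e∈ : ∀ u w → M (λ j → e u j - e w j)
    e-e∈ u w = ∈-resp-≗ (λ j → lemma (e u j) (e w j) (e u₀ j)) (−∈ (e-e₀∈ u) (e-e₀∈ w))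
      where lemma : ∀ x y z → (x - z) - (y - z) ≡ x - y
            lemma = solve-∀
    2e∈ : ∀ u → M (λ j → e u j + e u j)
    2e∈ u = ∈-resp-≗ (λ j → lemma (e u j) (e u₀ j)) (+∈ (+∈ (e-e₀∈ u) (e-e₀∈ u)) 2e₀∈)
      where lemma : ∀ x z → ((x - z) + (x - z)) + (z + z) ≡ x + x
            lemma = solve-∀

inN-refl : ∀ Γ x → inN Γ x x ≡ true
inN-refl Γ x = cong (_∨ adj Γ x x) (δ-refl x)

Undirected : Graph → Set
Undirected Γ = ∀ u v → inN Γ u v ≡ inN Γ v u

inCommon : (Γ : Graph) → Fin (N Γ) → Fin (N Γ) → Fin (N Γ) → Bool
inCommon Γ u v w = inN Γ u w ∧ inN Γ v w

commonParity : (Γ : Graph) → Fin (N Γ) → Fin (N Γ) → Bool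
commonParity Γ u v = inN Γ u · inN Γ v

data RArow (Γ : Graph) : (Fin (N Γ) → ℤ) → Set where
  closedNbhd : ∀ v → RArow Γ (λ w → indicator (inN Γ v w))
  commonNbhd : ∀ u v → RArow Γ (λ w → indicator (inCommon Γ u v w))

RowSpan : (Γ : Graph) → (Fin (N Γ) → ℤ) → Set
RowSpan Γ = Span (RArow Γ)

∈-RArows⁺ : ∀ Γ {r} → RArow Γ r → r ∈ RArows Γ
∈-RArows⁺ Γ (closedNbhd v) = ∈-++⁺ˡ (∈-tabulate⁺ v)
∈-RArows⁺ Γ (commonNbhd u v) =
  ∈-++⁺ʳ (tabulate (λ v w → indicator (inN Γ v w)))
         (∈-concatMap⁺ (λ u → tabulate (λ v w → indicator (inCommon Γ u v w)))
                       (Any.map (λ { refl → ∈-tabulate⁺ v }) (∈-tabulate⁺ {f = λ i → i} u)))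

∈-RArows⁻ : ∀ Γ {r} → r ∈ RArows Γ → RArow Γ r
∈-RArows⁻ Γ r∈ with ∈-++⁻ (tabulate (λ v w → indicator (inN Γ v w))) r∈
... | inj₁ r∈nbhds with ∈-tabulate⁻ r∈nbhds
...   | v , refl = closedNbhd v
∈-RArows⁻ Γ {r} r∈ | inj₂ r∈commons =
  common (tabulate (λ i → i))
         (∈-concatMap⁻ (λ u → tabulate (λ v w → indicator (inCommon Γ u v w))) r∈commons)
  where
  common : ∀ us → Any.Any (λ u → r ∈ tabulate (λ v w → indicator (inCommon Γ u v w))) us → RArow Γ r
  common (u ∷ us) (here r∈) with ∈-tabulate⁻ r∈
  ... | v , refl = commonNbhd u v
  common (u ∷ us) (there r∈) = common us r∈

inN-transport : ∀ Γ {v x y} → inN Γ v x ≡ true → δ x y ≡ true → inN Γ v y ≡ true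
inN-transport Γ {v} v~x δ≡true = subst (λ y → inN Γ v y ≡ true) (δ≡true⇒≡ δ≡true) v~x

inN-K : ∀ n (x y : Fin n) → inN (K n) x y ≡ true
inN-K n x y with x ≟ y
... | yes _ = refl
... | no _ = refl

K-undirected : ∀ n → Undirected (K n)
K-undirected n x y = trans (inN-K n x y) (sym (inN-K n y x))

combine-≢ˡ : ∀ {m n} {p q : Fin m} → p ≢ q → (x y : Fin n) → combine p x ≢ combine q y
combine-≢ˡ {p = p} {q} p≢q x y = p≢q ∘ proj₁ ∘ combine-injective p x q y

combine-≢ʳ : ∀ {m n} (p q : Fin m) {x y : Fin n} → x ≢ y → combine p x ≢ combine q y
combine-≢ʳ p q {x} {y} x≢y = x≢y ∘ proj₂ ∘ combine-injective p x q y

δ-combine : ∀ {m n} (p q : Fin m) (x y : Fin n) → δ (combine p x) (combine q y) ≡ δ p q ∧ δ x y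
δ-combine p q x y with p ≟ q | x ≟ y
... | yes refl | yes refl = δ-refl (combine p x)
... | yes refl | no x≢y = δ-≢ (combine-≢ʳ p p x≢y)
... | no p≢q | _ = δ-≢ (combine-≢ˡ p≢q x y)

∀-combine : ∀ {m n} (P : Fin (m ℕ.* n) → Set) → (∀ i j → P (combine i j)) → ∀ w → P w
∀-combine {m} {n} P P-combine w =
  subst P (combine-remQuot {m} n w) (P-combine (proj₁ (remQuot {m} n w)) (proj₂ (remQuot {m} n w)))

adj-□-combine : ∀ Γ₁ Γ₂ (p q : Fin (N Γ₁)) (x y : Fin (N Γ₂)) →
                adj (Γ₁ □ Γ₂) (combine p x) (combine q y) ≡
                (δ p q ∧ adj Γ₂ x y) ∨ (δ x y ∧ adj Γ₁ p q)
adj-□-combine Γ₁ Γ₂ p q x y = cong₂ adj-pairs (remQuot-combine p x) (remQuot-combine q y)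
  where
  adj-pairs : Fin (N Γ₁) × Fin (N Γ₂) → Fin (N Γ₁) × Fin (N Γ₂) → Bool
  adj-pairs (p , x) (q , y) = (δ p q ∧ adj Γ₂ x y) ∨ (δ x y ∧ adj Γ₁ p q)

inN-K□ : ∀ a Γ′ (p q : Fin a) (x y : Fin (N Γ′)) →
         inN (K a □ Γ′) (combine p x) (combine q y) ≡ δ x y ∨ (δ p q ∧ inN Γ′ x y)
inN-K□ a Γ′ p q x y =
  trans (cong₂ _∨_ (δ-combine p q x y) (adj-□-combine (K a) Γ′ p q x y))
        (by-cases (δ p q) (δ x y) (adj Γ′ x y))
  where
  by-cases : ∀ s d A → (s ∧ d) ∨ ((s ∧ A) ∨ (d ∧ not s)) ≡ d ∨ (s ∧ (d ∨ A))
  by-cases true true A = refl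
  by-cases true false A = ∨-identityʳ A
  by-cases false d A = trans (∧-identityʳ d) (sym (∨-identityʳ d))

inN-K□-column : ∀ a Γ′ (p q : Fin a) x → inN (K a □ Γ′) (combine p x) (combine q x) ≡ true
inN-K□-column a Γ′ p q x = trans (inN-K□ a Γ′ p q x x) (cong (_∨ (δ p q ∧ inN Γ′ x x)) (δ-refl x))

inN-K□-fibre : ∀ a Γ′ (p : Fin a) {x v} → inN Γ′ x v ≡ true →
               inN (K a □ Γ′) (combine p x) (combine p v) ≡ true
inN-K□-fibre a Γ′ p {x} {v} x~v =
  trans (inN-K□ a Γ′ p p x v)
        (trans (cong (λ s → δ x v ∨ (s ∧ inN Γ′ x v)) (δ-refl p))
               (trans (cong (δ x v ∨_) x~v) (∨-zeroʳ _)))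

K□-undirected : ∀ a Γ′ → Undirected Γ′ → Undirected (K a □ Γ′)
K□-undirected a Γ′ Γ′-undirected =
  ∀-combine _ λ p x → ∀-combine _ λ q y →
    trans (inN-K□ a Γ′ p q x y)
          (trans (cong₂ (λ d s → d ∨ (s ∧ inN Γ′ x y)) (δ-sym x y) (δ-sym p q))
                 (trans (cong (λ i → δ y x ∨ (δ q p ∧ i)) (Γ′-undirected x y))
                        (sym (inN-K□ a Γ′ q p y x))))

-- * Parities of common neighbourhoods in K a □ Γ′

⊗·⊗₃ : ∀ {m n} (f h₁ h₂ h₃ : Fin m → Bool) (g k₁ k₂ k₃ : Fin n → Bool) →
       (f ⊗ g) · (h₁ ⊗ k₁ ⊕ h₂ ⊗ k₂ ⊕ h₃ ⊗ k₃) ≡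
       (f · h₁ ∧ g · k₁) xor (f · h₂ ∧ g · k₂) xor (f · h₃ ∧ g · k₃)
⊗·⊗₃ f h₁ h₂ h₃ g k₁ k₂ k₃ =
  trans (·-⊕ʳ (f ⊗ g) (h₁ ⊗ k₁) (h₂ ⊗ k₂ ⊕ h₃ ⊗ k₃))
        (cong₂ _xor_ (·-⊗ f h₁ g k₁)
                     (trans (·-⊕ʳ (f ⊗ g) (h₂ ⊗ k₂) (h₃ ⊗ k₃))
                            (cong₂ _xor_ (·-⊗ f h₂ g k₂) (·-⊗ f h₃ g k₃))))

⊗₃·⊗₃ : ∀ {m n} (f₁ f₂ f₃ h₁ h₂ h₃ : Fin m → Bool) (g₁ g₂ g₃ k₁ k₂ k₃ : Fin n → Bool) →
        (f₁ ⊗ g₁ ⊕ f₂ ⊗ g₂ ⊕ f₃ ⊗ g₃) · (h₁ ⊗ k₁ ⊕ h₂ ⊗ k₂ ⊕ h₃ ⊗ k₃) ≡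
        ((f₁ · h₁ ∧ g₁ · k₁) xor (f₁ · h₂ ∧ g₁ · k₂) xor (f₁ · h₃ ∧ g₁ · k₃)) xor
        ((f₂ · h₁ ∧ g₂ · k₁) xor (f₂ · h₂ ∧ g₂ · k₂) xor (f₂ · h₃ ∧ g₂ · k₃)) xor
        ((f₃ · h₁ ∧ g₃ · k₁) xor (f₃ · h₂ ∧ g₃ · k₂) xor (f₃ · h₃ ∧ g₃ · k₃))
⊗₃·⊗₃ {m} {n} f₁ f₂ f₃ h₁ h₂ h₃ g₁ g₂ g₃ k₁ k₂ k₃ =
  trans (·-⊕ˡ (f₁ ⊗ g₁) (f₂ ⊗ g₂ ⊕ f₃ ⊗ g₃) H)
        (cong₂ _xor_ (⊗·⊗₃ f₁ h₁ h₂ h₃ g₁ k₁ k₂ k₃)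
                     (trans (·-⊕ˡ (f₂ ⊗ g₂) (f₃ ⊗ g₃) H)
                            (cong₂ _xor_ (⊗·⊗₃ f₂ h₁ h₂ h₃ g₂ k₁ k₂ k₃)
                                         (⊗·⊗₃ f₃ h₁ h₂ h₃ g₃ k₁ k₂ k₃))))
  where
  H : Fin (m ℕ.* n) → Bool
  H = h₁ ⊗ k₁ ⊕ h₂ ⊗ k₂ ⊕ h₃ ⊗ k₃

-- The nine dot products in N[(p, x)] · N[(q, v)], evaluated; the duplicated terms cancel over F₂.
collect-terms : ∀ o d e A P →
                ((o ∧ e) xor A xor e) xor (A xor (d ∧ P) xor (d ∧ A)) xor (e xor (d ∧ A) xor (d ∧ e))
                ≡ (o ∧ e) xor (d ∧ (P xor e))
collect-terms o d e A P =
  trans (regroup o d e A P)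
        (trans (cong (((o ∧ e) xor (d ∧ (P xor e))) xor_)
                     (cong₂ _xor_ (xor-same A) (cong₂ _xor_ (xor-same e) (xor-same (d ∧ A)))))
               (xor-identityʳ _))
  where
  regroup : ∀ o d e A P →
            ((o ∧ e) xor A xor e) xor (A xor (d ∧ P) xor (d ∧ A)) xor (e xor (d ∧ A) xor (d ∧ e))
            ≡ ((o ∧ e) xor (d ∧ (P xor e))) xor ((A xor A) xor (e xor e) xor ((d ∧ A) xor (d ∧ A)))
  regroup = solve 5 (λ o d e A P →
    ((o :* e) :+ (A :+ e)) :+ ((A :+ ((d :* P) :+ (d :* A))) :+ (e :+ ((d :* A) :+ (d :* e))))
    := ((o :* e) :+ (d :* (P :+ e))) :+ ((A :+ A) :+ ((e :+ e) :+ ((d :* A) :+ (d :* A))))) refl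
    where open xor-∧-Solver

module _ (a : ℕ) (Γ′ : Graph) where

  private
    Γ : Graph
    Γ = K a □ Γ′
    𝟙 : Fin a → Bool
    𝟙 _ = true

  -- (p, x) lies both in K_a × {x} and in {p} × N[x], hence the third summand.
  inN-K□-⊗ : ∀ (p : Fin a) (x : Fin (N Γ′)) w →
             inN Γ (combine p x) w ≡ (𝟙 ⊗ δ x ⊕ δ p ⊗ inN Γ′ x ⊕ δ p ⊗ δ x) w
  inN-K□-⊗ p x = ∀-combine _ λ q y →
    trans (inN-K□ a Γ′ p q x y)
          (trans (by-cases (δ x y) (δ p q) (inN Γ′ x y) (inN-transport Γ′ (inN-refl Γ′ x)))
                 (sym (cong₂ _xor_ (⊗-combine 𝟙 (δ x) q y)
                                   (cong₂ _xor_ (⊗-combine (δ p) (inN Γ′ x) q y)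
                                                (⊗-combine (δ p) (δ x) q y)))))
    where
    by-cases : ∀ d s α → (d ≡ true → α ≡ true) → d ∨ (s ∧ α) ≡ (true ∧ d) xor (s ∧ α) xor (s ∧ d)
    by-cases true s α d⇒α rewrite d⇒α refl | xor-same (s ∧ true) = refl
    by-cases false s α _ rewrite ∧-zeroʳ s = sym (xor-identityʳ (s ∧ α))

  commonParity-K□ : Undirected Γ′ → ∀ (p q : Fin a) (x v : Fin (N Γ′)) →
    commonParity Γ (combine p x) (combine q v) ≡
    (odd a ∧ δ x v) xor (δ p q ∧ (commonParity Γ′ x v xor δ x v))
  commonParity-K□ Γ′-undirected p q x v = begin
    commonParity Γ (combine p x) (combine q v)
      ≡⟨ ·-cong (inN-K□-⊗ p x) (inN-K□-⊗ q v) ⟩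
    (𝟙 ⊗ δ x ⊕ δ p ⊗ α ⊕ δ p ⊗ δ x) · (𝟙 ⊗ δ v ⊕ δ q ⊗ β ⊕ δ q ⊗ δ v)
      ≡⟨ ⊗₃·⊗₃ 𝟙 (δ p) (δ p) 𝟙 (δ q) (δ q) (δ x) α (δ x) (δ v) β (δ v) ⟩
    ((𝟙 · 𝟙 ∧ δ x · δ v) xor (𝟙 · δ q ∧ δ x · β) xor (𝟙 · δ q ∧ δ x · δ v)) xor
    ((δ p · 𝟙 ∧ α · δ v) xor (δ p · δ q ∧ α · β) xor (δ p · δ q ∧ α · δ v)) xor
    ((δ p · 𝟙 ∧ δ x · δ v) xor (δ p · δ q ∧ δ x · β) xor (δ p · δ q ∧ δ x · δ v))
      ≡⟨ dot-values ⟩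
    ((odd a ∧ δ x v) xor inN Γ′ x v xor δ x v) xor
    (inN Γ′ x v xor (δ p q ∧ commonParity Γ′ x v) xor (δ p q ∧ inN Γ′ x v)) xor
    (δ x v xor (δ p q ∧ inN Γ′ x v) xor (δ p q ∧ δ x v))
      ≡⟨ collect-terms (odd a) (δ p q) (δ x v) (inN Γ′ x v) (commonParity Γ′ x v) ⟩
    (odd a ∧ δ x v) xor (δ p q ∧ (commonParity Γ′ x v xor δ x v)) ∎
    where
    open ≡-Reasoning
    α β : Fin (N Γ′) → Bool
    α = inN Γ′ x
    β = inN Γ′ v
    dot-values :
      ((𝟙 · 𝟙 ∧ δ x · δ v) xor (𝟙 · δ q ∧ δ x · β) xor (𝟙 · δ q ∧ δ x · δ v)) xor
      ((δ p · 𝟙 ∧ α · δ v) xor (δ p · δ q ∧ α · β) xor (δ p · δ q ∧ α · δ v)) xor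
      ((δ p · 𝟙 ∧ δ x · δ v) xor (δ p · δ q ∧ δ x · β) xor (δ p · δ q ∧ δ x · δ v)) ≡
      ((odd a ∧ δ x v) xor inN Γ′ x v xor δ x v) xor
      (inN Γ′ x v xor (δ p q ∧ commonParity Γ′ x v) xor (δ p q ∧ inN Γ′ x v)) xor
      (δ x v xor (δ p q ∧ inN Γ′ x v) xor (δ p q ∧ δ x v))
    dot-values rewrite parity-true {a} | ·-δ 𝟙 q | δ-· p 𝟙 | δ-· p (δ q) | δ-· x (δ v) | δ-· x β
                     | ·-δ α v | Γ′-undirected v x | δ-sym q p | δ-sym v x = refl

commonParity-K : ∀ n (u v : Fin n) → commonParity (K n) u v ≡ odd n
commonParity-K n u v = trans (parity-cong (λ w → cong₂ _∧_ (inN-K n u w) (inN-K n v w))) (parity-true {n})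

indicator-∨ : ∀ A B → indicator (A ∨ B) ≡ indicator A + indicator B - indicator (A ∧ B)
indicator-∨ true true = refl
indicator-∨ true false = refl
indicator-∨ false true = refl
indicator-∨ false false = refl

indicator-∨-disjoint : ∀ A B → A ∧ B ≡ false → indicator (A ∨ B) ≡ indicator A + indicator B
indicator-∨-disjoint true false _ = refl
indicator-∨-disjoint false B _ = sym (ℤ.+-identityˡ (indicator B))

third-or-pair : ∀ {n} (p q : Fin n) → (∃ λ r → r ≢ p × r ≢ q) ⊎ (∀ r → r ≡ p ⊎ r ≡ q)
third-or-pair p q with any? (λ r → ¬? (r ≟ p) ×-dec ¬? (r ≟ q))
... | yes (r , r≢p , r≢q) = inj₁ (r , r≢p , r≢q)
... | no ∄r = inj₂ λ r → case-r r
  where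
  case-r : ∀ r → r ≡ p ⊎ r ≡ q
  case-r r with r ≟ p | r ≟ q
  ... | yes r≡p | _ = inj₁ r≡p
  ... | no _ | yes r≡q = inj₂ r≡q
  ... | no r≢p | no r≢q = ⊥-elim (∄r (r , r≢p , r≢q))

other : ∀ {n} → 2 ≤ n → (p : Fin n) → ∃ λ q → q ≢ p
other (s≤s (s≤s z≤n)) Fin.zero = Fin.suc Fin.zero , λ ()
other (s≤s (s≤s z≤n)) (Fin.suc p) = Fin.zero , λ ()

data Path (Γ : Graph) : Fin (N Γ) → Fin (N Γ) → Set where
  [] : ∀ {x} → Path Γ x x
  _∷_ : ∀ {x v y} → (x ≢ v × inN Γ x v ≡ true) → Path Γ v y → Path Γ x y

module RowSpan-K□ (a : ℕ) (Γ′ : Graph) (Γ′-undirected : Undirected Γ′) where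

  private
    Γ : Graph
    Γ = K a □ Γ′
    c : Fin a → Fin (N Γ′) → Fin (N Γ)
    c = combine

  open IsSubgroup (Span-isSubgroup (RArow Γ))

  inCommon-K□ : ∀ p q x v y₁ y → inCommon Γ (c p x) (c q v) (c y₁ y) ≡
                (δ x y ∨ (δ p y₁ ∧ inN Γ′ x y)) ∧ (δ v y ∨ (δ q y₁ ∧ inN Γ′ v y))
  inCommon-K□ p q x v y₁ y = cong₂ _∧_ (inN-K□ a Γ′ p y₁ x y) (inN-K□ a Γ′ q y₁ v y)

  inCommon-cross : ∀ {p q x v} → p ≢ q → x ≢ v → inN Γ′ x v ≡ true →
                   ∀ w → inCommon Γ (c p x) (c q v) w ≡ δ (c p v) w ∨ δ (c q x) w
  inCommon-cross {p} {q} {x} {v} p≢q x≢v x~v = ∀-combine _ λ y₁ y →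
    trans (inCommon-K□ p q x v y₁ y)
          (trans (by-cases (δ p y₁) (δ q y₁) (δ x y) (δ v y) (inN Γ′ x y) (inN Γ′ v y)
                           (δ-disjoint p≢q y₁) (δ-disjoint x≢v y)
                           (inN-transport Γ′ (trans (Γ′-undirected v x) x~v)) (inN-transport Γ′ x~v))
                 (sym (cong₂ _∨_ (δ-combine p y₁ v y) (δ-combine q y₁ x y))))
    where
    by-cases : ∀ s t d d′ α β → s ∧ t ≡ false → d ∧ d′ ≡ false →
               (d ≡ true → β ≡ true) → (d′ ≡ true → α ≡ true) →
               (d ∨ (s ∧ α)) ∧ (d′ ∨ (t ∧ β)) ≡ (s ∧ d′) ∨ (t ∧ d)
    by-cases s t true true α β _ () _ _
    by-cases true t true false α β _ _ d⇒β _ rewrite d⇒β refl = refl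
    by-cases false t true false α β _ _ d⇒β _ rewrite d⇒β refl = refl
    by-cases true t false true α β _ _ _ d′⇒α rewrite d′⇒α refl = refl
    by-cases false t false true α β _ _ _ _ = sym (∧-zeroʳ t)
    by-cases true true false false α β () _ _ _
    by-cases true false false false α β _ _ _ _ = ∧-zeroʳ α
    by-cases false t false false α β _ _ _ _ = sym (∧-zeroʳ t)

  cross-sum∈ : ∀ {p q x v} → p ≢ q → x ≢ v → inN Γ′ x v ≡ true →
               RowSpan Γ (λ w → e (c p v) w + e (c q x) w)
  cross-sum∈ {p} {q} {x} {v} p≢q x≢v x~v = ∈-resp-≗ pointwise (gen (commonNbhd (c p x) (c q v)))
    where
    pointwise : ∀ w → indicator (inCommon Γ (c p x) (c q v) w) ≡ e (c p v) w + e (c q x) w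
    pointwise w = trans (cong indicator (inCommon-cross p≢q x≢v x~v w))
                        (indicator-∨-disjoint (δ (c p v) w) (δ (c q x) w)
                                              (δ-disjoint (combine-≢ˡ p≢q v x) w))

  column : Fin (N Γ′) → Fin (N Γ) → Bool
  column x w = δ x (proj₂ (remQuot {a} (N Γ′) w))

  column-combine : ∀ x y₁ y → column x (c y₁ y) ≡ δ x y
  column-combine x y₁ y = cong (δ x ∘ proj₂) (remQuot-combine y₁ y)

  column∈ : ∀ {p q} x → p ≢ q → RowSpan Γ (λ w → indicator (column x w))
  column∈ {p} {q} x p≢q = ∈-resp-≗ pointwise (gen (commonNbhd (c p x) (c q x)))
    where
    by-cases : ∀ d s t α → s ∧ t ≡ false → (d ∨ (s ∧ α)) ∧ (d ∨ (t ∧ α)) ≡ d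
    by-cases true s t α _ = refl
    by-cases false true true α ()
    by-cases false true false α _ = ∧-zeroʳ α
    by-cases false false t α _ = refl
    pointwise : ∀ w → indicator (inCommon Γ (c p x) (c q x) w) ≡ indicator (column x w)
    pointwise = ∀-combine _ λ y₁ y → cong indicator
      (trans (inCommon-K□ p q x x y₁ y)
             (trans (by-cases (δ x y) (δ p y₁) (δ q y₁) (inN Γ′ x y) (δ-disjoint p≢q y₁))
                    (sym (column-combine x y₁ y))))

  fibre : ∀ {p x v} → x ≢ v → ∀ y₁ y → inCommon Γ (c p x) (c p v) (c y₁ y) ≡ δ p y₁ ∧ inCommon Γ′ x v y
  fibre {p} {x} {v} x≢v y₁ y =
    trans (inCommon-K□ p p x v y₁ y)
          (by-cases (δ p y₁) (δ x y) (δ v y) (inN Γ′ x y) (inN Γ′ v y) (δ-disjoint x≢v y)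
                    (inN-transport Γ′ (inN-refl Γ′ x)) (inN-transport Γ′ (inN-refl Γ′ v)))
    where
    by-cases : ∀ s d d′ α β → d ∧ d′ ≡ false → (d ≡ true → α ≡ true) → (d′ ≡ true → β ≡ true) →
               (d ∨ (s ∧ α)) ∧ (d′ ∨ (s ∧ β)) ≡ s ∧ (α ∧ β)
    by-cases s true true α β () _ _
    by-cases s true false α β _ d⇒α _ rewrite d⇒α refl = refl
    by-cases true false true α β _ _ d′⇒β rewrite d′⇒β refl = refl
    by-cases false false true α β _ _ _ = refl
    by-cases true false false α β _ _ _ = refl
    by-cases false false false α β _ _ _ = refl

  fibre-pair∈ : ∀ {p x v} → x ≢ v → ∀ {y z} → y ≢ z → (∀ w → inCommon Γ′ x v w ≡ δ y w ∨ δ z w) →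
                RowSpan Γ (λ w → e (c p y) w + e (c p z) w)
  fibre-pair∈ {p} {x} {v} x≢v {y} {z} y≢z N[x]∩N[v] =
    ∈-resp-≗ pointwise (gen (commonNbhd (c p x) (c p v)))
    where
    pointwise : ∀ w → indicator (inCommon Γ (c p x) (c p v) w) ≡ e (c p y) w + e (c p z) w
    pointwise = ∀-combine _ λ y₁ y′ →
      begin
        indicator (inCommon Γ (c p x) (c p v) (c y₁ y′))
      ≡⟨ cong indicator (trans (fibre x≢v y₁ y′) (cong (δ p y₁ ∧_) (N[x]∩N[v] y′))) ⟩
        indicator (δ p y₁ ∧ (δ y y′ ∨ δ z y′))
      ≡⟨ cong indicator (∧-distribˡ-∨ (δ p y₁) (δ y y′) (δ z y′)) ⟩
        indicator ((δ p y₁ ∧ δ y y′) ∨ (δ p y₁ ∧ δ z y′))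
      ≡⟨ indicator-∨-disjoint (δ p y₁ ∧ δ y y′) (δ p y₁ ∧ δ z y′) (disjoint (δ p y₁) y′) ⟩
        indicator (δ p y₁ ∧ δ y y′) + indicator (δ p y₁ ∧ δ z y′)
      ≡⟨ sym (cong₂ _+_ (cong indicator (δ-combine p y₁ y y′))
                        (cong indicator (δ-combine p y₁ z y′))) ⟩
        e (c p y) (c y₁ y′) + e (c p z) (c y₁ y′)
      ∎
      where
      open ≡-Reasoning
      disjoint : ∀ s y′ → (s ∧ δ y y′) ∧ (s ∧ δ z y′) ≡ false
      disjoint true y′ = δ-disjoint y≢z y′
      disjoint false y′ = refl

  private
    L : (Fin (N Γ) → ℤ) → Set
    L = RowSpan Γ
    L-sub : IsSubgroup L
    L-sub = Span-isSubgroup (RArow Γ)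

  linked-column : ∀ {p q x v} → p ≢ q → x ≢ v → inN Γ′ x v ≡ true → Linked L (c p x) (c q x)
  linked-column {p} {q} {x} {v} p≢q x≢v x~v with third-or-pair p q
  ... | inj₁ (r , r≢p , r≢q) =
    inj₁ (∈-resp-≗ (λ j → cancel (e (c r v) j) (e (c p x) j) (e (c q x) j))
                   (−∈ (cross-sum∈ r≢p x≢v x~v) (cross-sum∈ r≢q x≢v x~v)))
    where cancel : ∀ r y z → (r + y) - (r + z) ≡ y - z
          cancel = solve-∀
  ... | inj₂ p-or-q = inj₂ (∈-resp-≗ pointwise (column∈ x p≢q))
    where
    one-of : ∀ y₁ d → indicator d ≡ indicator (δ p y₁ ∧ d) + indicator (δ q y₁ ∧ d)
    one-of y₁ d with p-or-q y₁
    ... | inj₁ refl rewrite δ-refl y₁ | δ-≢ (p≢q ∘ sym) = sym (ℤ.+-identityʳ _)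
    ... | inj₂ refl rewrite δ-refl y₁ | δ-≢ p≢q = sym (ℤ.+-identityˡ _)
    pointwise : ∀ w → indicator (column x w) ≡ e (c p x) w + e (c q x) w
    pointwise = ∀-combine _ λ y₁ y →
      trans (cong indicator (column-combine x y₁ y))
            (trans (one-of y₁ (δ x y))
                   (sym (cong₂ _+_ (cong indicator (δ-combine p y₁ x y))
                                   (cong indicator (δ-combine q y₁ x y)))))

  linked-fibre-edge : ∀ {p q x v} → q ≢ p → x ≢ v → inN Γ′ x v ≡ true → Linked L (c p x) (c p v)
  linked-fibre-edge {p} {q} {x} {v} q≢p x≢v x~v =
    linked-trans L-sub {c p x} {c q v} {c p v} (inj₂ (cross-sum∈ (q≢p ∘ sym) (x≢v ∘ sym) v~x))
                                               (linked-column q≢p (x≢v ∘ sym) v~x)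
    where
    v~x : inN Γ′ v x ≡ true
    v~x = trans (Γ′-undirected v x) x~v

  linked-along-path : ∀ {p q x y} → q ≢ p → Path Γ′ x y → Linked L (c p x) (c p y)
  linked-along-path {p} {x = x} q≢p [] = linked-refl L-sub (c p x)
  linked-along-path {p} q≢p ((x≢v , x~v) ∷ path) =
    linked-trans L-sub {c p _} {c p _} {c p _} (linked-fibre-edge q≢p x≢v x~v) (linked-along-path q≢p path)

  all-linked : 2 ≤ a → (∀ x → ∃ λ v → x ≢ v × inN Γ′ x v ≡ true) → (∀ x y → Path Γ′ x y) →
               ∀ u w → Linked L u w
  all-linked 2≤a neighbour path = ∀-combine _ λ p x → ∀-combine _ λ q y →
    linked-trans L-sub {c p x} {c q x} {c q y} (change-fibre p q x)
                                               (linked-along-path (proj₂ (other 2≤a q)) (path x y))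
    where
    change-fibre : ∀ p q x → Linked L (c p x) (c q x)
    change-fibre p q x with p ≟ q
    ... | yes refl = linked-refl L-sub (c p x)
    ... | no p≢q = linked-column p≢q (proj₁ (proj₂ (neighbour x))) (proj₂ (proj₂ (neighbour x)))

  -- 2e_(p,x₀) = (e_(p,x₀) + e_(q,u)) − (e_(q,u) + e_(p,w₀)) + (e_(p,x₀) + e_(p,w₀)),
  -- a combination of three common-neighbourhood rows.
  2e∈-from-square : ∀ {p q} → q ≢ p → ∀ {u v x₀ w₀} → u ≢ v → x₀ ≢ w₀ → u ≢ x₀ → u ≢ w₀ →
                    (∀ y → inCommon Γ′ u v y ≡ δ x₀ y ∨ δ w₀ y) →
                    RowSpan Γ (λ j → e (c p x₀) j + e (c p x₀) j)
  2e∈-from-square {p} {q} q≢p {u} {v} {x₀} {w₀} u≢v x₀≢w₀ u≢x₀ u≢w₀ N[u]∩N[v] =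
    ∈-resp-≗ (λ j → lemma (e (c p x₀) j) (e (c q u) j) (e (c p w₀) j))
             (+∈ (−∈ (cross-sum∈ (q≢p ∘ sym) u≢x₀ u~x₀) (cross-sum∈ q≢p (u≢w₀ ∘ sym) w₀~u))
                 (fibre-pair∈ u≢v x₀≢w₀ N[u]∩N[v]))
    where
    in-first : ∀ {y} → inCommon Γ′ u v y ≡ true → inN Γ′ u y ≡ true
    in-first {y} = ∧-conicalˡ (inN Γ′ u y) (inN Γ′ v y)
    u~x₀ : inN Γ′ u x₀ ≡ true
    u~x₀ = in-first (trans (N[u]∩N[v] x₀) (cong (_∨ δ w₀ x₀) (δ-refl x₀)))
    w₀~u : inN Γ′ w₀ u ≡ true
    w₀~u = trans (Γ′-undirected w₀ u)
                 (in-first (trans (N[u]∩N[v] w₀) (trans (cong (δ x₀ w₀ ∨_) (δ-refl w₀)) (∨-zeroʳ _))))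
    lemma : ∀ x y z → ((x + y) - (y + z)) + (x + z) ≡ x + x
    lemma = solve-∀

  -- Inclusion–exclusion: e_(p,x) = (N[(p,x)] ∩ N[(p,v)]) + column x − N[(p,x)].
  dominated⇒e∈ : ∀ {x v} → x ≢ v → (∀ y → inCommon Γ′ x v y ≡ inN Γ′ x y) →
                 ∀ {p q} → p ≢ q → RowSpan Γ (e (c p x))
  dominated⇒e∈ {x} {v} x≢v N[x]⊆N[v] {p} {q} p≢q =
    ∈-resp-≗ pointwise (−∈ (+∈ (gen (commonNbhd (c p x) (c p v))) (column∈ x p≢q))
                           (gen (closedNbhd (c p x))))
    where
    absorb : ∀ d s α → (d ≡ true → α ≡ true) → d ∧ (s ∧ α) ≡ s ∧ d
    absorb true s α d⇒α rewrite d⇒α refl = refl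
    absorb false s α _ = sym (∧-zeroʳ s)
    inclusion-exclusion : ∀ A B C → (B + A) - (A + B - C) ≡ C
    inclusion-exclusion = solve-∀
    pointwise : ∀ w → indicator (inCommon Γ (c p x) (c p v) w) + indicator (column x w)
                      - indicator (inN Γ (c p x) w) ≡ e (c p x) w
    pointwise = ∀-combine _ at
      where
      at : ∀ y₁ y → indicator (inCommon Γ (c p x) (c p v) (c y₁ y)) + indicator (column x (c y₁ y))
                    - indicator (inN Γ (c p x) (c y₁ y)) ≡ e (c p x) (c y₁ y)
      at y₁ y = begin
          indicator (inCommon Γ (c p x) (c p v) (c y₁ y)) + indicator (column x (c y₁ y))
            - indicator (inN Γ (c p x) (c y₁ y))
        ≡⟨ cong₂ (λ r t → indicator r + indicator t - indicator (inN Γ (c p x) (c y₁ y)))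
                 (trans (fibre x≢v y₁ y) (cong (s ∧_) (N[x]⊆N[v] y))) (column-combine x y₁ y) ⟩
          indicator (s ∧ α) + indicator d - indicator (inN Γ (c p x) (c y₁ y))
        ≡⟨ cong (λ r → indicator (s ∧ α) + indicator d - r)
                (trans (cong indicator (inN-K□ a Γ′ p y₁ x y)) (indicator-∨ d (s ∧ α))) ⟩
          indicator (s ∧ α) + indicator d - (indicator d + indicator (s ∧ α) - indicator (d ∧ (s ∧ α)))
        ≡⟨ inclusion-exclusion (indicator d) (indicator (s ∧ α)) (indicator (d ∧ (s ∧ α))) ⟩
          indicator (d ∧ (s ∧ α))
        ≡⟨ cong indicator (trans (absorb d s α (inN-transport Γ′ (inN-refl Γ′ x)))
                                 (sym (δ-combine p y₁ x y))) ⟩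
          e (c p x) (c y₁ y)
        ∎
        where
        open ≡-Reasoning
        s d α : Bool
        s = δ p y₁
        d = δ x y
        α = inN Γ′ x y

private
  tail : ∀ {k} → (Fin (suc (suc k)) → ℕ) → Fin (suc k) → ℕ
  tail n = n ∘ Fin.suc

KProd-undirected : ∀ k n → Undirected (KProd (suc k) n)
KProd-undirected zero n = K-undirected (n Fin.zero)
KProd-undirected (suc k) n = K□-undirected (n Fin.zero) (KProd (suc k) (tail n)) (KProd-undirected k (tail n))

first-of : ∀ {n} → 2 ≤ n → Fin n
first-of (s≤s _) = Fin.zero

KProd-vertex : ∀ k n → (∀ i → 2 ≤ n i) → Fin (N (KProd (suc k) n))
KProd-vertex zero n 2≤n = first-of (2≤n Fin.zero)
KProd-vertex (suc k) n 2≤n = combine (first-of (2≤n Fin.zero)) (KProd-vertex k (tail n) (2≤n ∘ Fin.suc))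

KProd-neighbour : ∀ k n → (∀ i → 2 ≤ n i) → ∀ x → ∃ λ v → x ≢ v × inN (KProd (suc k) n) x v ≡ true
KProd-neighbour zero n 2≤n x =
  let v , v≢x = other (2≤n Fin.zero) x in v , v≢x ∘ sym , inN-K (n Fin.zero) x v
KProd-neighbour (suc k) n 2≤n = ∀-combine _ λ p x →
  let q , q≢p = other (2≤n Fin.zero) p
  in combine q x , combine-≢ˡ (q≢p ∘ sym) x x , inN-K□-column (n Fin.zero) (KProd (suc k) (tail n)) p q x

KProd-path : ∀ k n → ∀ x y → Path (KProd (suc k) n) x y
KProd-path zero n x y with x ≟ y
... | yes refl = []
... | no x≢y = (x≢y , inN-K (n Fin.zero) x y) ∷ []
KProd-path (suc k) n = ∀-combine _ λ p x → ∀-combine _ λ q y →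
  change-fibre p q x (in-fibre q (KProd-path k (tail n) x y))
  where
  Γ : Graph
  Γ = KProd (suc (suc k)) n
  in-fibre : ∀ q {x y} → Path (KProd (suc k) (tail n)) x y → Path Γ (combine q x) (combine q y)
  in-fibre q [] = []
  in-fibre q ((x≢v , x~v) ∷ path) =
    (combine-≢ʳ q q x≢v , inN-K□-fibre (n Fin.zero) (KProd (suc k) (tail n)) q x~v) ∷ in-fibre q path
  change-fibre : ∀ p q x {w} → Path Γ (combine q x) w → Path Γ (combine p x) w
  change-fibre p q x path with p ≟ q
  ... | yes refl = path
  ... | no p≢q = (combine-≢ˡ p≢q x x , inN-K□-column (n Fin.zero) (KProd (suc k) (tail n)) p q x) ∷ path

KProd-2e∈ : ∀ k n → (∀ i → 2 ≤ n i) → ∃ λ u → RowSpan (KProd (suc (suc k)) n) (λ j → e u j + e u j)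
KProd-2e∈ zero n 2≤n =
  let p = first-of (2≤n Fin.zero) ; q , q≢p = other (2≤n Fin.zero) p
      x = first-of (2≤n (Fin.suc Fin.zero)) ; v , v≢x = other (2≤n (Fin.suc Fin.zero)) x
      b = n (Fin.suc Fin.zero)
      e∈ = RowSpan-K□.dominated⇒e∈ (n Fin.zero) (K b) (K-undirected b) (v≢x ∘ sym)
             (λ y → trans (cong₂ _∧_ (inN-K b x y) (inN-K b v y)) (sym (inN-K b x y))) (q≢p ∘ sym)
  in combine p x , IsSubgroup.+∈ (Span-isSubgroup _) e∈ e∈
KProd-2e∈ (suc k) n 2≤n =
  let p = first-of (2≤n Fin.zero) ; q , q≢p = other (2≤n Fin.zero) p
      c₁ = first-of (2≤n (Fin.suc Fin.zero)) ; c₂ , c₂≢c₁ = other (2≤n (Fin.suc Fin.zero)) c₁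
      u = KProd-vertex k (tail (tail n)) (2≤n ∘ Fin.suc ∘ Fin.suc)
      v , u≢v , u~v = KProd-neighbour k (tail (tail n)) (2≤n ∘ Fin.suc ∘ Fin.suc) u
      c₁≢c₂ = c₂≢c₁ ∘ sym
  in combine p (combine c₁ v) ,
     RowSpan-K□.2e∈-from-square (n Fin.zero) (KProd (suc (suc k)) (tail n))
                                (KProd-undirected (suc k) (tail n)) q≢p
       (combine-≢ˡ c₁≢c₂ u v) (combine-≢ˡ c₁≢c₂ v u) (combine-≢ʳ c₁ c₁ u≢v) (combine-≢ˡ c₁≢c₂ u u)
       (RowSpan-K□.inCommon-cross (n (Fin.suc Fin.zero)) (KProd (suc k) (tail (tail n)))
                                  (KProd-undirected k (tail (tail n))) c₁≢c₂ u≢v u~v)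

KProd-checkerboard : ∀ k n → (∀ i → 2 ≤ n i) → ContainsCheckerboard (RowSpan (KProd (suc (suc k)) n))
KProd-checkerboard k n 2≤n =
  linked⇒checkerboard (Span-isSubgroup _)
    (RowSpan-K□.all-linked (n Fin.zero) (KProd (suc k) (tail n)) (KProd-undirected k (tail n)) (2≤n Fin.zero)
       (KProd-neighbour k (tail n) (2≤n ∘ Fin.suc)) (KProd-path k (tail n)))
    {proj₁ (KProd-2e∈ k n 2≤n)} (proj₂ (KProd-2e∈ k n 2≤n))

commonParity-KProd-even : ∀ k n → (∀ i → odd (n i) ≡ false) →
                          ∀ u v → commonParity (KProd (suc k) n) u v ≡ δ u v ∧ odd k
commonParity-KProd-even zero n even u v =
  trans (commonParity-K (n Fin.zero) u v) (trans (even Fin.zero) (sym (∧-zeroʳ (δ u v))))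
commonParity-KProd-even (suc k) n even = ∀-combine _ λ p x → ∀-combine _ λ q v →
  begin
    commonParity (KProd (suc (suc k)) n) (combine p x) (combine q v)
  ≡⟨ commonParity-K□ (n Fin.zero) (KProd (suc k) (tail n)) (KProd-undirected k (tail n)) p q x v ⟩
    (odd (n Fin.zero) ∧ δ x v) xor (δ p q ∧ (commonParity (KProd (suc k) (tail n)) x v xor δ x v))
  ≡⟨ cong₂ (λ o P → (o ∧ δ x v) xor (δ p q ∧ (P xor δ x v))) (even Fin.zero)
           (commonParity-KProd-even k (tail n) (even ∘ Fin.suc) x v) ⟩
    false xor (δ p q ∧ ((δ x v ∧ odd k) xor δ x v))
  ≡⟨ by-cases (δ p q) (δ x v) (odd k) ⟩
    (δ p q ∧ δ x v) ∧ not (odd k)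
  ≡⟨ cong (_∧ odd (suc k)) (sym (δ-combine p q x v)) ⟩
    δ (combine p x) (combine q v) ∧ odd (suc k)
  ∎
  where
  open ≡-Reasoning
  by-cases : ∀ s d o → false xor (s ∧ ((d ∧ o) xor d)) ≡ (s ∧ d) ∧ not o
  by-cases false d o = refl
  by-cases true false o = refl
  by-cases true true false = refl
  by-cases true true true = refl

commonParity-KProd-odd : ∀ k n → (∀ i → 2 ≤ n i) → ∀ i → odd (n i) ≡ true →
                         ∃ λ u → ∃ λ v → u ≢ v × commonParity (KProd (suc k) n) u v ≡ true
commonParity-KProd-odd zero n 2≤n Fin.zero odd-n₀ =
  let p = first-of (2≤n Fin.zero) ; q , q≢p = other (2≤n Fin.zero) p
  in p , q , q≢p ∘ sym , trans (commonParity-K _ p q) odd-n₀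
commonParity-KProd-odd (suc k) n 2≤n Fin.zero odd-n₀ =
  combine p x , combine q x , combine-≢ˡ (q≢p ∘ sym) x x ,
  trans (commonParity-K□ (n Fin.zero) (KProd (suc k) (tail n)) (KProd-undirected k (tail n)) p q x x)
        (trans (cong₂ (λ o d → (o ∧ δ x x) xor (d ∧ (commonParity (KProd (suc k) (tail n)) x x xor δ x x)))
                      odd-n₀ (δ-≢ (q≢p ∘ sym)))
               (cong (_xor false) (δ-refl x)))
  where
  p q : Fin (n Fin.zero)
  p = first-of (2≤n Fin.zero)
  q = proj₁ (other (2≤n Fin.zero) p)
  q≢p : q ≢ p
  q≢p = proj₂ (other (2≤n Fin.zero) p)
  x : Fin (N (KProd (suc k) (tail n)))
  x = KProd-vertex k (tail n) (2≤n ∘ Fin.suc)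
commonParity-KProd-odd (suc k) n 2≤n (Fin.suc i) odd-nᵢ
  with commonParity-KProd-odd k (tail n) (2≤n ∘ Fin.suc) i odd-nᵢ
... | x , v , x≢v , odd-xv =
  combine p x , combine p v , combine-≢ʳ p p x≢v ,
  trans (commonParity-K□ (n Fin.zero) (KProd (suc k) (tail n)) (KProd-undirected k (tail n)) p p x v)
        (trans (cong₂ (λ d P → (odd (n Fin.zero) ∧ d) xor (δ p p ∧ (P xor d))) (δ-≢ x≢v) odd-xv)
               (trans (cong (λ s → (odd (n Fin.zero) ∧ false) xor (s ∧ true)) (δ-refl p))
                      (cong (_xor true) (∧-zeroʳ (odd (n Fin.zero))))))
  where
  p : Fin (n Fin.zero)
  p = first-of (2≤n Fin.zero)

-- * Row-span membership of every eᵥ implies RA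

module Powers {c ℓ} (G : Group c ℓ) where
  open Group G renaming (refl to ≈-refl; sym to ≈-sym; trans to ≈-trans)
  open import Algebra.Properties.Group G using (\\-leftDividesˡ; \\-leftDividesʳ; inverseʳ-unique)
  open import Relation.Binary.Reasoning.Setoid setoid

  infixr 8 _^ℕ_ _^_

  _^ℕ_ : Carrier → ℕ → Carrier
  g ^ℕ zero = ε
  g ^ℕ suc n = g ∙ g ^ℕ n

  _^_ : Carrier → ℤ → Carrier
  g ^ + n = g ^ℕ n
  g ^ -[1+ n ] = (g ⁻¹) ^ℕ suc n

  ^-suc : ∀ g i → g ^ (+ 1 + i) ≈ g ∙ g ^ i
  ^-suc g (+ n) = ≈-refl
  ^-suc g -[1+ zero ] = ≈-sym (≈-trans (∙-congˡ (identityʳ (g ⁻¹))) (inverseʳ g))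
  ^-suc g -[1+ suc n ] = ≈-sym (\\-leftDividesˡ g ((g ⁻¹) ^ℕ suc n))

  ^-pred : ∀ g i → g ^ (-[1+ 0 ] + i) ≈ g ⁻¹ ∙ g ^ i
  ^-pred g (+ zero) = ≈-refl
  ^-pred g (+ suc n) = ≈-sym (\\-leftDividesʳ g (g ^ℕ n))
  ^-pred g -[1+ n ] = ≈-refl

  ^-+ : ∀ g i j → g ^ (i + j) ≈ g ^ i ∙ g ^ j
  ^-+ g (+ zero) j = ≈-trans (reflexive (cong (g ^_) (ℤ.+-identityˡ j))) (≈-sym (identityˡ (g ^ j)))
  ^-+ g (+ suc m) j = begin
    g ^ (+ suc m + j)       ≡⟨ cong (g ^_) (ℤ.+-assoc (+ 1) (+ m) j) ⟩
    g ^ (+ 1 + (+ m + j))   ≈⟨ ^-suc g (+ m + j) ⟩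
    g ∙ g ^ (+ m + j)       ≈⟨ ∙-congˡ (^-+ g (+ m) j) ⟩
    g ∙ (g ^ℕ m ∙ g ^ j)    ≈⟨ assoc g (g ^ℕ m) (g ^ j) ⟨
    g ^ℕ suc m ∙ g ^ j      ∎
  ^-+ g -[1+ zero ] j = ≈-trans (^-pred g j) (∙-congʳ (≈-sym (identityʳ (g ⁻¹))))
  ^-+ g -[1+ suc m ] j = begin
    g ^ (-[1+ suc m ] + j)             ≡⟨ cong (g ^_) (ℤ.+-assoc -[1+ 0 ] -[1+ m ] j) ⟩
    g ^ (-[1+ 0 ] + (-[1+ m ] + j))    ≈⟨ ^-pred g (-[1+ m ] + j) ⟩
    g ⁻¹ ∙ g ^ (-[1+ m ] + j)          ≈⟨ ∙-congˡ (^-+ g -[1+ m ] j) ⟩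
    g ⁻¹ ∙ (g ^ -[1+ m ] ∙ g ^ j)      ≈⟨ assoc (g ⁻¹) (g ^ -[1+ m ]) (g ^ j) ⟨
    g ^ -[1+ suc m ] ∙ g ^ j           ∎

  ^-neg : ∀ g i → g ^ (- i) ≈ (g ^ i) ⁻¹
  ^-neg g i = inverseʳ-unique (g ^ i) (g ^ (- i))
                (≈-trans (≈-sym (^-+ g i (- i))) (reflexive (cong (g ^_) (ℤ.+-inverseʳ i))))

  ^-indicator : ∀ g b → (if b then g else ε) ≈ g ^ indicator b
  ^-indicator g true = ≈-sym (identityʳ g)
  ^-indicator g false = ≈-refl

  ∏ : ∀ {n} → (Fin n → Carrier) → Carrier
  ∏ {zero} f = ε
  ∏ {suc n} f = f Fin.zero ∙ ∏ (f ∘ Fin.suc)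

  ∏-cong : ∀ {n} {f h : Fin n → Carrier} → (∀ v → f v ≈ h v) → ∏ f ≈ ∏ h
  ∏-cong {zero} f≈h = ≈-refl
  ∏-cong {suc n} f≈h = ∙-cong (f≈h Fin.zero) (∏-cong (f≈h ∘ Fin.suc))

  ∏-ε : ∀ n → ∏ {n} (λ _ → ε) ≈ ε
  ∏-ε zero = ≈-refl
  ∏-ε (suc n) = ≈-trans (identityˡ _) (∏-ε n)

  ∏-δ : ∀ {n} (w : Fin n) g → ∏ (λ v → if δ v w then g else ε) ≈ g
  ∏-δ {suc n} Fin.zero g = ≈-trans (∙-congˡ (∏-ε n)) (identityʳ g)
  ∏-δ {suc n} (Fin.suc w) g =
    ≈-trans (identityˡ _) (≈-trans (∏-cong (λ v → reflexive (cong (if_then g else ε) (δ-suc v w)))) (∏-δ w g))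

module _ (Γ : Graph) (G : Group 0ℓ 0ℓ) where
  open Group G renaming (Carrier to A; refl to ≈-refl; sym to ≈-sym; trans to ≈-trans)
  open import Algebra.Properties.Group G using (ε⁻¹≈ε)
  open Powers G

  InGΓ-∏ : ∀ {n} (F : Fin n → Fin (N Γ) → A) → (∀ v → InGΓ G Γ (F v)) → InGΓ G Γ (λ w → ∏ (λ v → F v w))
  InGΓ-∏ {zero} F F∈ = unit
  InGΓ-∏ {suc n} F F∈ = mul (F∈ Fin.zero) (InGΓ-∏ (F ∘ Fin.suc) (F∈ ∘ Fin.suc))

  commonNbhd-commutator∈ : ∀ a b u v → InGΓ G Γ (λ w → if inCommon Γ u v w then a ⁻¹ ∙ b ⁻¹ ∙ a ∙ b else ε)
  commonNbhd-commutator∈ a b u v =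
    resp pointwise (mul (mul (mul (inv (gen a u)) (inv (gen b v))) (gen a u)) (gen b v))
    where
    pointwise : ∀ w → (if inN Γ u w then a else ε) ⁻¹ ∙ (if inN Γ v w then b else ε) ⁻¹
                      ∙ (if inN Γ u w then a else ε) ∙ (if inN Γ v w then b else ε)
                      ≈ (if inCommon Γ u v w then a ⁻¹ ∙ b ⁻¹ ∙ a ∙ b else ε)
    pointwise w with inN Γ u w | inN Γ v w
    ... | true | true = ≈-refl
    ... | true | false = ≈-trans (identityʳ _) (≈-trans (∙-congʳ (≈-trans (∙-congˡ ε⁻¹≈ε) (identityʳ _))) (inverseˡ a))
    ... | false | true = ≈-trans (∙-congʳ (≈-trans (identityʳ _) (≈-trans (∙-congʳ ε⁻¹≈ε) (identityˡ _)))) (inverseˡ b)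
    ... | false | false =
      ≈-trans (identityʳ _) (≈-trans (identityʳ _) (≈-trans (∙-congʳ ε⁻¹≈ε) (≈-trans (identityˡ _) ε⁻¹≈ε)))

  rowSpan-power∈ : ∀ a b {f} → RowSpan Γ f → InGΓ G Γ (λ w → (a ⁻¹ ∙ b ⁻¹ ∙ a ∙ b) ^ f w)
  rowSpan-power∈ a b (gen (closedNbhd v)) = resp (λ w → ^-indicator _ (inN Γ v w)) (gen _ v)
  rowSpan-power∈ a b (gen (commonNbhd u v)) =
    resp (λ w → ^-indicator _ (inCommon Γ u v w)) (commonNbhd-commutator∈ a b u v)
  rowSpan-power∈ a b nil = unit
  rowSpan-power∈ a b (add {f} {h} f∈ h∈) =
    resp (λ w → ≈-sym (^-+ _ (f w) (h w))) (mul (rowSpan-power∈ a b f∈) (rowSpan-power∈ a b h∈))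
  rowSpan-power∈ a b (neg {f} f∈) = resp (λ w → ≈-sym (^-neg _ (f w))) (inv (rowSpan-power∈ a b f∈))
  rowSpan-power∈ a b (resp f≗h f∈) = resp (λ w → reflexive (cong (_ ^_) (f≗h w))) (rowSpan-power∈ a b f∈)

  module _ (e∈ : ∀ v → RowSpan Γ (e v)) where

    point-commutator∈ : ∀ v {g} → InComm G g → InGΓ G Γ (λ w → if δ v w then g else ε)
    point-commutator∈ v (comm a b) = resp (λ w → ≈-sym (^-indicator _ (δ v w))) (rowSpan-power∈ a b (e∈ v))
    point-commutator∈ v unit = resp (λ w → ≈-sym (if-ε (δ v w))) unit
      where
      if-ε : ∀ d → (if d then ε else ε) ≈ ε
      if-ε true = ≈-refl
      if-ε false = ≈-refl
    point-commutator∈ v (mul {g} {h} g∈ h∈) = resp pointwise (mul (point-commutator∈ v g∈) (point-commutator∈ v h∈))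
      where
      pointwise : ∀ w → (if δ v w then g else ε) ∙ (if δ v w then h else ε) ≈ (if δ v w then g ∙ h else ε)
      pointwise w with δ v w
      ... | true = ≈-refl
      ... | false = identityʳ ε
    point-commutator∈ v (inv {g} g∈) = resp pointwise (inv (point-commutator∈ v g∈))
      where
      pointwise : ∀ w → (if δ v w then g else ε) ⁻¹ ≈ (if δ v w then g ⁻¹ else ε)
      pointwise w with δ v w
      ... | true = ≈-refl
      ... | false = ε⁻¹≈ε
    point-commutator∈ v (resp {g} {h} g≈h g∈) = resp pointwise (point-commutator∈ v g∈)
      where
      pointwise : ∀ w → (if δ v w then g else ε) ≈ (if δ v w then h else ε)
      pointwise w with δ v w
      ... | true = g≈h
      ... | false = ≈-refl

e∈RowSpan⇒RA : ∀ Γ → (∀ v → RowSpan Γ (e v)) → RA Γ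
e∈RowSpan⇒RA Γ e∈ G x x∈[G,G] =
  resp (λ w → ≈-trans (∏-cong (λ v → by-δ v w)) (∏-δ w (x w)))
       (InGΓ-∏ Γ G (λ v w → if δ v w then x v else ε) (λ v → point-commutator∈ Γ G e∈ v (x∈[G,G] v)))
  where
  open Group G renaming (refl to ≈-refl; trans to ≈-trans)
  open Powers G
  by-δ : ∀ v w → (if δ v w then x v else ε) ≈ (if δ v w then x w else ε)
  by-δ v w with v ≟ w
  ... | yes refl = ≈-refl
  ... | no _ = ≈-refl

-- * The obstruction: the Heisenberg group over F₂

record H₃ : Set where
  constructor h₃
  field
    a b c : Bool

-- Upper unitriangular 3 × 3 matrices over F₂, (a, b, c) standing for [[1, a, c], [0, 1, b], [0, 0, 1]].
_∙H_ : H₃ → H₃ → H₃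
h₃ a b c ∙H h₃ a′ b′ c′ = h₃ (a xor a′) (b xor b′) (c xor c′ xor (a ∧ b′))

εH : H₃
εH = h₃ false false false

_⁻¹H : H₃ → H₃
h₃ a b c ⁻¹H = h₃ a b (c xor (a ∧ b))

h₃-cong : ∀ {a a′ b b′ c c′} → a ≡ a′ → b ≡ b′ → c ≡ c′ → h₃ a b c ≡ h₃ a′ b′ c′
h₃-cong refl refl refl = refl

Heisenberg : Group 0ℓ 0ℓ
Heisenberg = record
  { Carrier = H₃ ; _≈_ = _≡_ ; _∙_ = _∙H_ ; ε = εH ; _⁻¹ = _⁻¹H
  ; isGroup = record
    { isMonoid = record
      { isSemigroup = record
        { isMagma = record { isEquivalence = isEquivalence ; ∙-cong = cong₂ _∙H_ }
        ; assoc = λ { (h₃ a b c) (h₃ a′ b′ c′) (h₃ a″ b″ c″) →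
                      h₃-cong (xor-assoc a a′ a″) (xor-assoc b b′ b″) (assoc-c a a′ b′ b″ c c′ c″) } }
      ; identity = (λ { (h₃ a b c) → h₃-cong refl refl (xor-identityʳ c) })
                 , (λ { (h₃ a b c) → h₃-cong (xor-identityʳ a) (xor-identityʳ b)
                                             (trans (cong (c xor_) (∧-zeroʳ a)) (xor-identityʳ c)) }) }
    ; inverse = (λ { (h₃ a b c) → h₃-cong (xor-same a) (xor-same b) (xor-same (c xor (a ∧ b))) })
              , (λ { (h₃ a b c) → h₃-cong (xor-same a) (xor-same b) (inverseʳ-c a b c) })
    ; ⁻¹-cong = cong _⁻¹H } }
  where
  open xor-∧-Solver
  assoc-c : ∀ a a′ b′ b″ c c′ c″ →
            (c xor c′ xor (a ∧ b′)) xor c″ xor ((a xor a′) ∧ b″) ≡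
            c xor (c′ xor c″ xor (a′ ∧ b″)) xor (a ∧ (b′ xor b″))
  assoc-c = solve 7 (λ a a′ b′ b″ c c′ c″ →
    (c :+ (c′ :+ (a :* b′))) :+ (c″ :+ ((a :+ a′) :* b″)) :=
    c :+ ((c′ :+ (c″ :+ (a′ :* b″))) :+ (a :* (b′ :+ b″)))) refl
  inverseʳ-c : ∀ a b c → c xor (c xor (a ∧ b)) xor (a ∧ b) ≡ false
  inverseʳ-c a b c =
    trans (cong (c xor_) (trans (xor-assoc c (a ∧ b) (a ∧ b))
                                (trans (cong (c xor_) (xor-same (a ∧ b))) (xor-identityʳ c))))
          (xor-same c)

data F₂Span (Γ : Graph) : (Fin (N Γ) → Bool) → Set where
  nil : F₂Span Γ (λ _ → false)
  add : ∀ v {z} → F₂Span Γ z → F₂Span Γ (inN Γ v ⊕ z)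
  resp : ∀ {z z′} → (∀ w → z w ≡ z′ w) → F₂Span Γ z → F₂Span Γ z′

F₂Span-⊕ : ∀ {Γ z z′} → F₂Span Γ z → F₂Span Γ z′ → F₂Span Γ (z ⊕ z′)
F₂Span-⊕ nil z′∈ = z′∈
F₂Span-⊕ {Γ} {z′ = z′} (add v {z} z∈) z′∈ =
  resp (λ w → sym (xor-assoc (inN Γ v w) (z w) (z′ w))) (add v (F₂Span-⊕ z∈ z′∈))
F₂Span-⊕ {z′ = z′} (resp z≗ z∈) z′∈ = resp (λ w → cong (_xor z′ w) (z≗ w)) (F₂Span-⊕ z∈ z′∈)

module _ (Γ : Graph) (even : ∀ u v → commonParity Γ u v ≡ false) where

  nbhd-⊥-F₂Span : ∀ v {z} → F₂Span Γ z → inN Γ v · z ≡ false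
  nbhd-⊥-F₂Span v nil = trans (parity-cong (λ w → ∧-zeroʳ (inN Γ v w))) (parity-false {N Γ})
  nbhd-⊥-F₂Span v (add u {z} z∈) =
    trans (·-⊕ʳ (inN Γ v) (inN Γ u) z) (cong₂ _xor_ (even v u) (nbhd-⊥-F₂Span v z∈))
  nbhd-⊥-F₂Span v (resp z≗ z∈) = trans (·-cong (λ _ → refl) (sym ∘ z≗)) (nbhd-⊥-F₂Span v z∈)

  F₂Span-isotropic : ∀ {z z′} → F₂Span Γ z → F₂Span Γ z′ → z · z′ ≡ false
  F₂Span-isotropic nil z′∈ = parity-false {N Γ}
  F₂Span-isotropic {z′ = z′} (add v {z} z∈) z′∈ =
    trans (·-⊕ˡ (inN Γ v) z z′) (cong₂ _xor_ (nbhd-⊥-F₂Span v z′∈) (F₂Span-isotropic z∈ z′∈))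
  F₂Span-isotropic (resp z≗ z∈) z′∈ = trans (·-cong (sym ∘ z≗) (λ _ → refl)) (F₂Span-isotropic z∈ z′∈)

  record Invariant (x : Fin (N Γ) → H₃) : Set where
    field
      a∈ : F₂Span Γ (H₃.a ∘ x)
      b∈ : F₂Span Γ (H₃.b ∘ x)
      c-even : parity (H₃.c ∘ x) ≡ false

  invariant : ∀ {x} → InGΓ Heisenberg Γ x → Invariant x
  invariant (gen g v) = record
    { a∈ = resp (λ w → component H₃.a refl w) (scaled (H₃.a g))
    ; b∈ = resp (λ w → component H₃.b refl w) (scaled (H₃.b g))
    ; c-even = trans (parity-cong (λ w → sym (component H₃.c refl w)))
                     (trans (parity-∧ʳ (inN Γ v) (H₃.c g))
                            (cong (_∧ H₃.c g) (trans (parity-cong (λ w → sym (∧-idem (inN Γ v w)))) (even v v))))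
    }
    where
    component : ∀ (f : H₃ → Bool) → f εH ≡ false → ∀ w → inN Γ v w ∧ f g ≡ f (if inN Γ v w then g else εH)
    component f fε≡false w with inN Γ v w
    ... | true = refl
    ... | false = sym fε≡false
    scaled : ∀ s → F₂Span Γ (λ w → inN Γ v w ∧ s)
    scaled true = resp (λ w → trans (xor-identityʳ _) (sym (∧-identityʳ _))) (add v nil)
    scaled false = resp (λ w → sym (∧-zeroʳ (inN Γ v w))) nil
  invariant unit = record { a∈ = nil ; b∈ = nil ; c-even = parity-false {N Γ} }
  invariant (mul {x} {y} x∈ y∈) = record
    { a∈ = F₂Span-⊕ (a∈ X) (a∈ Y)
    ; b∈ = F₂Span-⊕ (b∈ X) (b∈ Y)
    ; c-even = trans (parity-xor (H₃.c ∘ x) _)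
                     (trans (cong₂ _xor_ (c-even X) (parity-xor (H₃.c ∘ y) _))
                            (cong₂ _xor_ (c-even Y) (F₂Span-isotropic (a∈ X) (b∈ Y))))
    }
    where
    open Invariant
    X : Invariant x
    X = invariant x∈
    Y : Invariant y
    Y = invariant y∈
  invariant (inv {x} x∈) = record
    { a∈ = a∈ X ; b∈ = b∈ X
    ; c-even = trans (parity-xor (H₃.c ∘ x) _) (cong₂ _xor_ (c-even X) (F₂Span-isotropic (a∈ X) (b∈ X)))
    }
    where
    open Invariant
    X : Invariant x
    X = invariant x∈
  invariant (resp {x} x≗y x∈) = record
    { a∈ = resp (cong H₃.a ∘ x≗y) (a∈ X)
    ; b∈ = resp (cong H₃.b ∘ x≗y) (b∈ X)
    ; c-even = trans (parity-cong (sym ∘ cong H₃.c ∘ x≗y)) (c-even X)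
    }
    where
    open Invariant
    X : Invariant x
    X = invariant x∈

  -- The central element (0, 0, 1) is the commutator of (1, 0, 0) and (0, 1, 0).
  commonParity-even⇒¬RA : Fin (N Γ) → ¬ RA Γ
  commonParity-even⇒¬RA w₀ ra with Invariant.c-even (invariant (ra Heisenberg central-at-w₀ central∈[G,G]))
    where
    central-at-w₀ : Fin (N Γ) → H₃
    central-at-w₀ w = if δ w₀ w then h₃ false false true else εH
    central∈[G,G] : ∀ w → InComm Heisenberg (central-at-w₀ w)
    central∈[G,G] w with δ w₀ w
    ... | true = comm (h₃ true false false) (h₃ false true false)
    ... | false = unit
  ... | c-even = true≢false (trans (sym (trans (parity-cong central-c) (parity-δ w₀ (λ _ → true)))) c-even)
    where
    central-c : ∀ w → H₃.c (if δ w₀ w then h₃ false false true else εH) ≡ δ w₀ w ∧ true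
    central-c w with δ w₀ w
    ... | true = refl
    ... | false = refl
    true≢false : true ≢ false
    true≢false ()

-- * The Hermite normal form when all common neighbourhoods are even

e-refl : ∀ {n} (x : Fin n) → e x x ≡ + 1
e-refl x = cong indicator (δ-refl x)

e-≢ : ∀ {n} {x y : Fin n} → x ≢ y → e x y ≡ + 0
e-≢ x≢y = cong indicator (δ-≢ x≢y)

module _ {n} (σ : Fin n ↔ Fin n) where
  private
    to from : Fin n → Fin n
    to = Inverse.to σ
    from = Inverse.from σ

  δ-∘-to : ∀ x j → δ x (to j) ≡ δ (from x) j
  δ-∘-to x j with x ≟ to j | from x ≟ j
  ... | yes _ | yes _ = refl
  ... | no _ | no _ = refl
  ... | yes x≡to-j | no from-x≢j =
    ⊥-elim (from-x≢j (trans (cong from x≡to-j) (Inverse.strictlyInverseʳ σ j)))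
  ... | no x≢to-j | yes from-x≡j =
    ⊥-elim (x≢to-j (trans (sym (Inverse.strictlyInverseˡ σ x)) (cong to from-x≡j)))

  e-∘-to : ∀ x j → e x (to j) ≡ e (from x) j
  e-∘-to x j = cong indicator (δ-∘-to x j)

  module _ {M : (Fin n → ℤ) → Set} (M-sub : IsSubgroup M) where
    open IsSubgroup M-sub

    ∘-to-isSubgroup : IsSubgroup (λ f → M (f ∘ to))
    ∘-to-isSubgroup = record { 0∈ = 0∈ ; +∈ = +∈ ; -∈ = -∈ ; ∈-resp-≗ = λ f≗g → ∈-resp-≗ (f≗g ∘ to) }

    ∘-to-containsCheckerboard : ContainsCheckerboard M → ContainsCheckerboard (λ f → M (f ∘ to))
    ∘-to-containsCheckerboard D = record
      { e-e∈ = λ x y → ∈-resp-≗ (λ j → sym (cong₂ _-_ (e-∘-to x j) (e-∘-to y j))) (e-e∈ (from x) (from y))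
      ; 2e∈ = λ x → ∈-resp-≗ (λ j → sym (cong₂ _+_ (e-∘-to x j) (e-∘-to x j))) (2e∈ (from x))
      }
      where open ContainsCheckerboard D

even-row : ∀ Γ → (∀ u v → commonParity Γ u v ≡ false) →
           ∀ {r} → RArow Γ r → ∃ λ b → parity b ≡ false × (∀ w → r w ≡ indicator (b w))
even-row Γ even (closedNbhd v) =
  inN Γ v , trans (parity-cong (λ w → sym (∧-idem (inN Γ v w)))) (even v v) , λ _ → refl
even-row Γ even (commonNbhd u v) = inCommon Γ u v , even u v , λ _ → refl

RowSpan⇒permRows : ∀ Γ σ {f} → RowSpan Γ f → Span (_∈ permRows Γ σ) (λ j → f (Inverse.to σ j))
RowSpan⇒permRows Γ σ (gen r) = gen (∈-map⁺ (λ r j → r (Inverse.to σ j)) (∈-RArows⁺ Γ r))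
RowSpan⇒permRows Γ σ nil = nil
RowSpan⇒permRows Γ σ (add f∈ g∈) = add (RowSpan⇒permRows Γ σ f∈) (RowSpan⇒permRows Γ σ g∈)
RowSpan⇒permRows Γ σ (neg f∈) = neg (RowSpan⇒permRows Γ σ f∈)
RowSpan⇒permRows Γ σ (resp f≗g f∈) = resp (f≗g ∘ Inverse.to σ) (RowSpan⇒permRows Γ σ f∈)

module _ (Γ : Graph) (L : Fin (N Γ)) (L-last : suc (toℕ L) ≡ N Γ) where

  H : Fin (N Γ) → Fin (N Γ) → ℤ
  H i j = e i j + e L j

  private
    ≤L : ∀ i → toℕ i ℕ.≤ toℕ L
    ≤L i = ℕ.≤-pred (subst (toℕ i ℕ.<_) (sym L-last) (toℕ<n i))

  H-isHNF : IsHNF H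
  H-isHNF = below-diagonal , positive-pivot , above-diagonal
    where
    below-diagonal : ∀ i j → toℕ j ℕ.< toℕ i → H i j ≡ + 0
    below-diagonal i j j<i
      rewrite e-≢ {x = i} {y = j} (λ i≡j → ℕ.<⇒≢ j<i (cong toℕ (sym i≡j)))
            | e-≢ {x = L} {y = j} (λ L≡j → ℕ.<⇒≢ (ℕ.<-≤-trans j<i (≤L i)) (cong toℕ (sym L≡j))) = refl
    pivot : ∀ i → H i i ≡ + 1 + e L i
    pivot i = cong (_+ e L i) (e-refl i)
    positive-pivot : ∀ i → + 0 ℤ.< H i i
    positive-pivot i rewrite pivot i with δ L i
    ... | true = ℤ.+<+ (s≤s z≤n)
    ... | false = ℤ.+<+ (s≤s z≤n)
    above-diagonal : ∀ i j → toℕ i ℕ.< toℕ j → (+ 0 ℤ.≤ H i j) × (H i j ℤ.< H j j)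
    above-diagonal i j i<j rewrite e-≢ {x = i} {y = j} (ℕ.<⇒≢ i<j ∘ cong toℕ) | pivot j with δ L j
    ... | true = ℤ.+≤+ z≤n , ℤ.+<+ (s≤s (s≤s z≤n))
    ... | false = ℤ.+≤+ z≤n , ℤ.+<+ (s≤s z≤n)

  H-diagonal : ∀ i → (suc (toℕ i) ℕ.< N Γ → H i i ≡ + 1) × (suc (toℕ i) ≡ N Γ → H i i ≡ + 2)
  H-diagonal i = not-last , last
    where
    not-last : suc (toℕ i) ℕ.< N Γ → H i i ≡ + 1
    not-last i<L rewrite e-refl i
                       | e-≢ {x = L} {y = i} (λ L≡i → ℕ.<-irrefl (trans (cong (suc ∘ toℕ) (sym L≡i)) L-last) i<L) = refl
    last : suc (toℕ i) ≡ N Γ → H i i ≡ + 2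
    last i-last with toℕ-injective {i = i} {j = L} (ℕ.suc-injective (trans i-last (sym L-last)))
    ... | refl rewrite e-refl L = refl

  H-containsCheckerboard : ContainsCheckerboard (Span (_∈ tabulate H))
  H-containsCheckerboard = record
    { e-e∈ = λ x y → ∈-resp-≗ (λ j → cancel (e x j) (e y j) (e L j)) (−∈ (row x) (row y))
    ; 2e∈ = λ x → ∈-resp-≗ (λ j → double (e x j) (e L j)) (−∈ (+∈ (row x) (row x)) (row L))
    }
    where
    open IsSubgroup (Span-isSubgroup (_∈ tabulate H))
    row : ∀ i → Span (_∈ tabulate H) (H i)
    row i = gen (∈-tabulate⁺ i)
    cancel : ∀ x y z → (x + z) - (y + z) ≡ x - y
    cancel = solve-∀
    double : ∀ x z → ((x + z) + (x + z)) - (z + z) ≡ x + x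
    double = solve-∀


  permRows⊆H : (∀ u v → commonParity Γ u v ≡ false) → ∀ σ r → r ∈ permRows Γ σ → InSpan (tabulate H) r
  permRows⊆H even σ r r∈ with ∈-map⁻ (λ r j → r (Inverse.to σ j)) r∈
  ... | ρ , ρ∈ , refl with even-row Γ even (∈-RArows⁻ Γ ρ∈)
  ...   | b , b-even , ρ≗b =
    Span⇒InSpan (∈-resp-≗ (λ j → sym (ρ≗b (Inverse.to σ j)))
                  (even-indicator∈ (∘-to-isSubgroup σ H-sub)
                                   (∘-to-containsCheckerboard σ H-sub H-containsCheckerboard) b b-even))
    where
    H-sub : IsSubgroup (Span (_∈ tabulate H))
    H-sub = Span-isSubgroup (_∈ tabulate H)
    open IsSubgroup H-sub

  H⊆permRows : ContainsCheckerboard (RowSpan Γ) → ∀ σ i → InSpan (permRows Γ σ) (H i)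
  H⊆permRows D σ i = Span⇒InSpan (resp pointwise (RowSpan⇒permRows Γ σ ei+eL∈))
    where
    open ContainsCheckerboard D
    open IsSubgroup (Span-isSubgroup (RArow Γ))
    to : Fin (N Γ) → Fin (N Γ)
    to = Inverse.to σ
    sum : ∀ x y → (x - y) + (y + y) ≡ x + y
    sum = solve-∀
    ei+eL∈ : RowSpan Γ (λ j → e (to i) j + e (to L) j)
    ei+eL∈ = ∈-resp-≗ (λ j → sum (e (to i) j) (e (to L) j)) (+∈ (e-e∈ (to i) (to L)) (2e∈ (to L)))
    pointwise : ∀ j → e (to i) (to j) + e (to L) (to j) ≡ H i j
    pointwise j = cong₂ _+_ (trans (e-∘-to σ (to i) j) (cong (λ x → e x j) (Inverse.strictlyInverseʳ σ i)))
                            (trans (e-∘-to σ (to L) j) (cong (λ x → e x j) (Inverse.strictlyInverseʳ σ L)))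

last-of : ∀ {n} → Fin n → Σ (Fin n) λ L → suc (toℕ L) ≡ n
last-of {suc n} _ = Fin.fromℕ n , cong suc (toℕ-fromℕ n)

even+checkerboard⇒½RA : ∀ Γ → (∀ u v → commonParity Γ u v ≡ false) → ContainsCheckerboard (RowSpan Γ) →
                        Fin (N Γ) → OneOverRA Γ 2
even+checkerboard⇒½RA Γ even D x₀ =
  let L , L-last = last-of x₀
  in s≤s z≤n , λ σ → H Γ L L-last , H-isHNF Γ L L-last ,
                     (permRows⊆H Γ L L-last even σ , H⊆permRows Γ L L-last D σ) , H-diagonal Γ L L-last

2∣⇒odd≡false : ∀ n → 2 ∣ n → odd n ≡ false
2∣⇒odd≡false n (divides q refl) = double q
  where
  double : ∀ q → odd (q ℕ.* 2) ≡ false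
  double zero = refl
  double (suc q) = trans (not-involutive (odd (q ℕ.* 2))) (double q)

odd≡false⇒2∣ : ∀ n → odd n ≡ false → 2 ∣ n
odd≡false⇒2∣ zero _ = divides 0 refl
odd≡false⇒2∣ (suc (suc n)) even with odd≡false⇒2∣ n (trans (sym (not-involutive (odd n))) even)
... | divides q refl = divides (suc q) refl

some-odd-or-all-even : ∀ {m} (n : Fin m → ℕ) → (∃ λ i → odd (n i) ≡ true) ⊎ (∀ i → odd (n i) ≡ false)
some-odd-or-all-even n with any? (λ i → odd (n i) Bool.≟ true)
... | yes some-odd = inj₁ some-odd
... | no no-odd = inj₂ λ i → ¬-not (λ odd-nᵢ → no-odd (i , odd-nᵢ))

odd-commonNbhd⇒RA : ∀ Γ → ContainsCheckerboard (RowSpan Γ) → ∀ u v → commonParity Γ u v ≡ true → RA Γ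
odd-commonNbhd⇒RA Γ D u v odd =
  e∈RowSpan⇒RA Γ (odd-indicator∈⇒e∈ (Span-isSubgroup _) D (inCommon Γ u v) odd (gen (commonNbhd u v)))

module _ (k : ℕ) (n : Fin (suc (suc k)) → ℕ) (2≤n : ∀ i → 2 ≤ n i) where
  private
    Γ : Graph
    Γ = KProd (suc (suc k)) n
    D : ContainsCheckerboard (RowSpan Γ)
    D = KProd-checkerboard k n 2≤n

  KProd-RA-if-odd-factor : ∀ i → odd (n i) ≡ true → RA Γ
  KProd-RA-if-odd-factor i odd-nᵢ =
    let u , v , _ , odd-uv = commonParity-KProd-odd (suc k) n 2≤n i odd-nᵢ in odd-commonNbhd⇒RA Γ D u v odd-uv

  module _ (all-even : ∀ i → odd (n i) ≡ false) where
    private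
      x : Fin (N Γ)
      x = KProd-vertex (suc k) n 2≤n

    KProd-RA-if-even-order : odd (suc k) ≡ true → RA Γ
    KProd-RA-if-even-order odd-k+1 =
      odd-commonNbhd⇒RA Γ D x x
        (trans (commonParity-KProd-even (suc k) n all-even x x) (cong₂ _∧_ (δ-refl x) odd-k+1))

    KProd-½RA∧¬RA-if-odd-order : odd (suc k) ≡ false → OneOverRA Γ 2 × ¬ RA Γ
    KProd-½RA∧¬RA-if-odd-order even-k+1 = even+checkerboard⇒½RA Γ even D x , commonParity-even⇒¬RA Γ even x
      where
      even : ∀ u v → commonParity Γ u v ≡ false
      even u v = trans (commonParity-KProd-even (suc k) n all-even u v)
                       (trans (cong (δ u v ∧_) even-k+1) (∧-zeroʳ (δ u v)))

RA-with : ∀ {Γ} {C : Set} → RA Γ → C → (OneOverRA Γ 2 ⊎ RA Γ) × (RA Γ ⇔ C)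
RA-with ra c = inj₂ ra , mk⇔ (λ _ → c) (λ _ → ra)

mainTheorem9 : (m : ℕ) → 2 ≤ m → (n : Fin m → ℕ) → (∀ i → 2 ≤ n i) →
                 (OneOverRA (KProd m n) 2 ⊎ RA (KProd m n)) ×
                 (RA (KProd m n) ⇔ (2 ∣ m ⊎ ∃[ i ] ¬ (2 ∣ n i)))
mainTheorem9 (suc (suc k)) (s≤s (s≤s z≤n)) n 2≤n with some-odd-or-all-even n | odd (suc k) Bool.≟ true
... | inj₁ (i , odd-nᵢ) | _ =
  RA-with (KProd-RA-if-odd-factor k n 2≤n i odd-nᵢ) (inj₂ (i , not-¬ odd-nᵢ ∘ 2∣⇒odd≡false (n i)))
... | inj₂ all-even | yes odd-k+1 =
  RA-with (KProd-RA-if-even-order k n 2≤n all-even odd-k+1) (inj₁ (odd≡false⇒2∣ (suc (suc k)) (cong not odd-k+1)))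
... | inj₂ all-even | no ¬odd-k+1 =
  let ½RA , ¬RA = KProd-½RA∧¬RA-if-odd-order k n 2≤n all-even (¬-not ¬odd-k+1)
  in inj₁ ½RA , mk⇔ (⊥-elim ∘ ¬RA) (⊥-elim ∘ ¬condition)
  where
  ¬condition : ¬ (2 ∣ suc (suc k) ⊎ ∃[ i ] ¬ (2 ∣ n i))
  ¬condition (inj₁ 2∣m) =
    ¬odd-k+1 (trans (sym (not-involutive (odd (suc k)))) (cong not (2∣⇒odd≡false (suc (suc k)) 2∣m)))
  ¬condition (inj₂ (i , 2∤nᵢ)) = 2∤nᵢ (odd≡false⇒2∣ (n i) (all-even i))
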